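{- Let $p,q$ be distinct primes, $n,m$ positive integers, $\alpha=\frac{p^n-1}{p-1}$, $\beta=\frac{q^m-1}{q-1}$. Let \[ T_1=\begin{bmatrix} 0& p^n-1 & (p^n-1)(q^m-1) & q^m-1\\ 1& p-2 & (p-1)(q^m-1) & 0\\ 1& p-1 & (p-1)(q-1)-1 & q-1\\ 1& 0 & (p^n-1)(q-1) & q-2 \end{bmatrix} \] and let $T_2$ be the square matrix of order $1+\alpha+\alpha\beta+\beta$ given in block form (blocks of sizes $1,\alpha,\alpha\beta,\beta$) by \[ T_2=\begin{bmatrix} 0& (p-1)\mathbf{1}'_\alpha & (p-1)(q-1)\mathbf{1}'_{\alpha\beta} & (q-1)\mathbf{1}'_\beta\\ \mathbf{1}_\alpha & (p-2)I_\alpha & (p-1)(q-1)\, I_\alpha\otimes\mathbf{1}'_\beta & O\\ \mathbf{1}_{\alpha\beta} & (p-1)\, I_\alpha\otimes\mathbf{1}_\beta & ((p-1)(q-1)-1)I_{\alpha\beta} & (q-1)\,\mathbf{1}_\alpha\otimes I_\beta\\ \mathbf{1}_\beta & O & (p-1)(q-1)\,\mathbf{1}'_\alpha\otimes I_\beta & (q-2)I_\beta \end{bmatrix}. \] Then \[ \phi(T_2,x)=\phi(T_1,x)\,(x-pq+p+q)^{(\alpha-1)(\beta-1)} f(x)^{\alpha-1}g(x)^{\beta-1}, \] where $f(x)$ and $g(x)$ are the characteristic polynomials of $\begin{bmatrix} p-2 & (p-1)(q^m-1)\\ p-1 & (p-1)(q-1)-1\end{bmatrix}$ and $\begin{bmatrix}(p-1)(q-1)-1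 & q-1\\ (p^n-1)(q-1) & q-2\end{bmatrix}$, respectively.
   Context: $\phi(B,x)=\det(xI-B)$. $\mathbf{1}_k$ is the all-ones column vector of length $k$, $'$ denotes transpose, $I_k$ the identity matrix, $O$ a zero matrix of appropriate size, and $\otimes$ the Kronecker product. -}

module Defs where

open import Data.Nat as ℕ using (ℕ; zero; suc)
open import Data.Integer using (ℤ; +_; _+_; _-_; _*_; -_; _^_)
open import Data.Fin using (Fin; zero; suc; punchIn; toℕ; splitAt; remQuot; _≟_)
open import Data.Vec using (Vec; []; _∷_; lookup)
open import Data.Sum using (_⊎_; inj₁; inj₂)
open import Data.Product using (_×_; _,_)
open import Data.Unit using (⊤; tt)
open import Data.Bool using (if_then_else_)
open import Relation.Nullary using (does)

Mat : ℕ → Set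
Mat n = Fin n → Fin n → ℤ

Σ[<] : (n : ℕ) → (Fin n → ℤ) → ℤ
Σ[<] zero    f = + 0
Σ[<] (suc n) f = f zero + Σ[<] n (λ i → f (suc i))

sign : ℕ → ℤ
sign k = (- + 1) ^ k

det : (n : ℕ) → Mat n → ℤ
det zero    M = + 1
det (suc n) M = Σ[<] (suc n) (λ j → sign (toℕ j) * (M zero j * det n (λ i k → M (suc i) (punchIn j k))))

δ : ∀ {k} → Fin k → Fin k → ℤ
δ i j = if does (i ≟ j) then + 1 else + 0

I : (n : ℕ) → Mat n
I n i j = δ i j

φ : (n : ℕ) → Mat n → ℤ → ℤ
φ n B x = det n (λ i j → x * I n i j - B i j)

fromRows : ∀ {n} → Vec (Vec ℤ n) n → Mat n
fromRows rows i j = lookup (lookup rows i) j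

module _ (α β : ℕ) where
  -- block index: first block (size 1), second (α), third (αβ, pairs (i,j)
  -- in Kronecker order i*β + j), fourth (β)
  Idx : Set
  Idx = ⊤ ⊎ Fin α ⊎ (Fin α × Fin β) ⊎ Fin β

  N : ℕ
  N = 1 ℕ.+ α ℕ.+ α ℕ.* β ℕ.+ β

  toIdx : Fin N → Idx
  toIdx k with splitAt (1 ℕ.+ α ℕ.+ α ℕ.* β) k
  ... | inj₂ j = inj₂ (inj₂ (inj₂ j))
  ... | inj₁ k₁ with splitAt (1 ℕ.+ α) k₁
  ...   | inj₂ ij = inj₂ (inj₂ (inj₁ (remQuot β ij)))
  ...   | inj₁ k₂ with splitAt 1 k₂
  ...     | inj₁ _ = inj₁ tt
  ...     | inj₂ i = inj₂ (inj₁ i)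


module _ (p q n m : ℕ) where
  private
    P Q : ℤ
    P = + p
    Q = + q

  T₁ : Mat 4
  T₁ = fromRows
    ( (+ 0 ∷ P ^ n - + 1 ∷ (P ^ n - + 1) * (Q ^ m - + 1) ∷ Q ^ m - + 1 ∷ [])
    ∷ (+ 1 ∷ P - + 2 ∷ (P - + 1) * (Q ^ m - + 1) ∷ + 0 ∷ [])
    ∷ (+ 1 ∷ P - + 1 ∷ (P - + 1) * (Q - + 1) - + 1 ∷ Q - + 1 ∷ [])
    ∷ (+ 1 ∷ + 0 ∷ (P ^ n - + 1) * (Q - + 1) ∷ Q - + 2 ∷ [])
    ∷ [])

  Fmat : Mat 2
  Fmat = fromRows
    ( (P - + 2 ∷ (P - + 1) * (Q ^ m - + 1) ∷ [])
    ∷ (P - + 1 ∷ (P - + 1) * (Q - + 1) - + 1 ∷ [])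
    ∷ [])

  Gmat : Mat 2
  Gmat = fromRows
    ( ((P - + 1) * (Q - + 1) - + 1 ∷ Q - + 1 ∷ [])
    ∷ ((P ^ n - + 1) * (Q - + 1) ∷ Q - + 2 ∷ [])
    ∷ [])

  f g : ℤ → ℤ
  f = φ 2 Fmat
  g = φ 2 Gmat

  module _ (α β : ℕ) where
    T₂blk : Idx α β → Idx α β → ℤ
    T₂blk (inj₁ _) (inj₁ _) = + 0
    T₂blk (inj₁ _) (inj₂ (inj₁ _)) = P - + 1
    T₂blk (inj₁ _) (inj₂ (inj₂ (inj₁ _))) = (P - + 1) * (Q - + 1)
    T₂blk (inj₁ _) (inj₂ (inj₂ (inj₂ _))) = Q - + 1
    T₂blk (inj₂ (inj₁ _)) (inj₁ _) = + 1
    T₂blk (inj₂ (inj₁ i)) (inj₂ (inj₁ i')) = (P - + 2) * δ i i'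
    T₂blk (inj₂ (inj₁ i)) (inj₂ (inj₂ (inj₁ (i' , _)))) = (P - + 1) * (Q - + 1) * δ i i'
    T₂blk (inj₂ (inj₁ _)) (inj₂ (inj₂ (inj₂ _))) = + 0
    T₂blk (inj₂ (inj₂ (inj₁ _))) (inj₁ _) = + 1
    T₂blk (inj₂ (inj₂ (inj₁ (i , _)))) (inj₂ (inj₁ i')) = (P - + 1) * δ i i'
    T₂blk (inj₂ (inj₂ (inj₁ (i , j)))) (inj₂ (inj₂ (inj₁ (i' , j')))) =
      ((P - + 1) * (Q - + 1) - + 1) * (δ i i' * δ j j')
    T₂blk (inj₂ (inj₂ (inj₁ (_ , j)))) (inj₂ (inj₂ (inj₂ j'))) = (Q - + 1) * δ j j'
    T₂blk (inj₂ (inj₂ (inj₂ _))) (inj₁ _) = + 1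
    T₂blk (inj₂ (inj₂ (inj₂ _))) (inj₂ (inj₁ _)) = + 0
    T₂blk (inj₂ (inj₂ (inj₂ j))) (inj₂ (inj₂ (inj₁ (_ , j')))) = (P - + 1) * (Q - + 1) * δ j j'
    T₂blk (inj₂ (inj₂ (inj₂ j))) (inj₂ (inj₂ (inj₂ j'))) = (Q - + 2) * δ j j'

    T₂ : Mat (N α β)
    T₂ r c = T₂blk (toIdx α β r) (toIdx α β c)

module Submission where

-- Index xI − T₂ by the blocks U, A i, AB i j, B j of T₂. For each i the
-- indices A i and AB i j (j < β) form one of α identical copies of a block D,
-- all coupled in the same way to the shared indices U and B j. For a matrix
-- [[A, 1ᵀ ⊗ B], [1 ⊗ C, I ⊗ D]] with k copies, subtracting the columns of the
-- first copy from those of another copy and adding the rows of that copy to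
-- those of the first leaves a block triangular matrix, and so
-- det = det [[A, k B], [C, D]] · det D ^ (k − 1). This is applied to the α
-- copies {A i, AB i j}, then to the β copies {AB j, B j} of the resulting
-- matrix, and to the β copies AB j inside D. Using pⁿ − 1 = α (p − 1) and
-- qᵐ − 1 = β (q − 1), what remains are exactly xI − T₁, the matrices defining
-- g and f, and the 1 × 1 blocks x − ((p − 1)(q − 1) − 1) = x − pq + p + q.

open import Defs
open import Data.Empty using (⊥-elim)
open import Data.Fin as F using (Fin; zero; suc; punchIn; punchOut; toℕ; inject₁; cast; splitAt; combine; _↑ˡ_; _↑ʳ_)
open import Data.Fin.Patterns using (0F; 1F; 2F; 3F)
import Data.Fin.Properties as FP
open import Data.Integer using (ℤ; +_; _+_; _-_; _*_; -_; _^_)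
import Data.Integer.Properties as ℤP
open import Algebra.Properties.CommutativeSemigroup ℤP.+-commutativeSemigroup using () renaming (interchange to +-interchange)
open import Algebra.Properties.CommutativeSemigroup ℤP.*-commutativeSemigroup using () renaming (interchange to *-interchange)
open import Data.Integer.Tactic.RingSolver using (solve-∀)
open import Data.List using (List; []; _∷_; _++_; [_]; length; map; lookup; concat; concatMap; tabulate; allFin)
import Data.List.Properties as LP
open import Data.List.Membership.Propositional using (_∈_)
open import Data.List.Membership.Propositional.Properties using (∈-tabulate⁺; ∈-lookup)
open import Data.List.Relation.Binary.Permutation.Propositional as Perm
  using (_↭_; ↭-refl; ↭-prep; ↭-trans; module PermutationReasoning)
import Data.List.Relation.Binary.Permutation.Propositional.Properties as ↭
open import Data.List.Relation.Unary.All as All using (All; []; _∷_)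
import Data.List.Relation.Unary.All.Properties as All
open import Data.List.Relation.Unary.AllPairs as AllPairs using (_∷_)
open import Data.List.Relation.Unary.Unique.Propositional using (Unique)
import Data.List.Relation.Unary.Unique.Propositional.Properties as Unique
open import Data.Nat as ℕ using (ℕ; zero; suc; _∸_; NonZero)
import Data.Nat.Properties as ℕP
open import Data.Nat.Primality using (Prime; prime⇒nonTrivial)
open import Data.Product using (∃; _×_; _,_)
open import Data.Sum using (_⊎_; inj₁; inj₂; [_,_]′)
open import Data.Unit using (⊤; tt)
open import Relation.Binary.Definitions using (tri<; tri≈; tri>)
open import Relation.Binary.PropositionalEquality hiding ([_])
open import Relation.Nullary using (yes; no; Dec)

-- Determinants

Σ-cong : ∀ n {f g : Fin n → ℤ} → (∀ i → f i ≡ g i) → Σ[<] n f ≡ Σ[<] n g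
Σ-cong zero    e = refl
Σ-cong (suc n) e = cong₂ _+_ (e zero) (Σ-cong n (λ i → e (suc i)))

Σ-zero : ∀ n {f : Fin n → ℤ} → (∀ i → f i ≡ + 0) → Σ[<] n f ≡ + 0
Σ-zero zero    e = refl
Σ-zero (suc n) e = cong₂ _+_ (e zero) (Σ-zero n (λ i → e (suc i)))

Σ-+ : ∀ n (f g : Fin n → ℤ) → Σ[<] n (λ i → f i + g i) ≡ Σ[<] n f + Σ[<] n g
Σ-+ zero    f g = refl
Σ-+ (suc n) f g = trans (cong (_+_ (f zero + g zero)) (Σ-+ n (λ i → f (suc i)) (λ i → g (suc i))))
                        (+-interchange (f zero) (g zero) _ _)

Σ-*ˡ : ∀ n c (f : Fin n → ℤ) → Σ[<] n (λ i → c * f i) ≡ c * Σ[<] n f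
Σ-*ˡ zero    c f = sym (ℤP.*-zeroʳ c)
Σ-*ˡ (suc n) c f = trans (cong (_+_ (c * f zero)) (Σ-*ˡ n c (λ i → f (suc i))))
                         (sym (ℤP.*-distribˡ-+ c (f zero) _))

Σ-*ʳ : ∀ n c (f : Fin n → ℤ) → Σ[<] n (λ i → f i * c) ≡ Σ[<] n f * c
Σ-*ʳ n c f = trans (Σ-cong n (λ i → ℤP.*-comm (f i) c)) (trans (Σ-*ˡ n c f) (ℤP.*-comm c _))

Σ-comm : ∀ m n (f : Fin m → Fin n → ℤ) →
         Σ[<] m (λ i → Σ[<] n (f i)) ≡ Σ[<] n (λ j → Σ[<] m (λ i → f i j))
Σ-comm zero    n f = sym (Σ-zero n (λ _ → refl))
Σ-comm (suc m) n f = trans (cong (_+_ (Σ[<] n (f zero))) (Σ-comm m n (λ i → f (suc i))))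
                           (sym (Σ-+ n (f zero) _))

Σ-↑ : ∀ m n (f : Fin (m ℕ.+ n) → ℤ) →
      Σ[<] (m ℕ.+ n) f ≡ Σ[<] m (λ i → f (i ↑ˡ n)) + Σ[<] n (λ j → f (m ↑ʳ j))
Σ-↑ zero    n f = sym (ℤP.+-identityˡ _)
Σ-↑ (suc m) n f = trans (cong (_+_ (f zero)) (Σ-↑ m n (λ i → f (suc i))))
                        (sym (ℤP.+-assoc (f zero) _ _))

minor : ∀ {n} → Mat (suc n) → Fin (suc n) → Mat n
minor M j i k = M (suc i) (punchIn j k)

cofactorTerm : ∀ {n} → Mat (suc n) → Fin (suc n) → ℤ
cofactorTerm {n} M j = sign (toℕ j) * (M zero j * det n (minor M j))

det-cong : ∀ n {M M′ : Mat n} → (∀ i j → M i j ≡ M′ i j) → det n M ≡ det n M′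
det-cong zero    e = refl
det-cong (suc n) e = Σ-cong (suc n) (λ j →
  cong₂ (λ a d → sign (toℕ j) * (a * d)) (e zero j) (det-cong n (λ i k → e (suc i) (punchIn j k))))

sign-suc : ∀ k → sign (suc k) ≡ - sign k
sign-suc k = ℤP.-1*i≡-i (sign k)

det-linear-column : ∀ n (M A B : Mat n) (k : Fin n) (a b : ℤ) →
  (∀ i j → j ≢ k → M i j ≡ A i j) → (∀ i j → j ≢ k → M i j ≡ B i j) →
  (∀ i → M i k ≡ a * A i k + b * B i k) → det n M ≡ a * det n A + b * det n B
det-linear-column (suc n) M A B k a b eA eB ek =
  trans (Σ-cong (suc n) term)
    (trans (Σ-+ (suc n) (λ j → a * cofactorTerm A j) (λ j → b * cofactorTerm B j))
           (cong₂ _+_ (Σ-*ˡ (suc n) a (cofactorTerm A)) (Σ-*ˡ (suc n) b (cofactorTerm B))))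
  where
  distrib-row : ∀ a b s x y d → s * ((a * x + b * y) * d) ≡ a * (s * (x * d)) + b * (s * (y * d))
  distrib-row = solve-∀
  distrib-minor : ∀ a b s x d d′ → s * (x * (a * d + b * d′)) ≡ a * (s * (x * d)) + b * (s * (x * d′))
  distrib-minor = solve-∀
  term : ∀ j → cofactorTerm M j ≡ a * cofactorTerm A j + b * cofactorTerm B j
  term j with j F.≟ k
  ... | yes refl =
    trans (cong₂ (λ x d → sign (toℕ j) * (x * d)) (ek zero) minorMA)
      (trans (distrib-row a b (sign (toℕ j)) (A zero j) (B zero j) (det n (minor A j)))
             (cong (λ d → a * cofactorTerm A j + b * (sign (toℕ j) * (B zero j * d)))
                   (trans (sym minorMA) minorMB)))
    where
    minorMA = det-cong n (λ i l → eA (suc i) (punchIn j l) (FP.punchInᵢ≢i j l))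
    minorMB = det-cong n (λ i l → eB (suc i) (punchIn j l) (FP.punchInᵢ≢i j l))
  ... | no j≢k =
    trans (cong (λ d → sign (toℕ j) * (M zero j * d)) minor-linear)
      (trans (distrib-minor a b (sign (toℕ j)) (M zero j) (det n (minor A j)) (det n (minor B j)))
             (cong₂ (λ x y → a * (sign (toℕ j) * (x * det n (minor A j))) + b * (sign (toℕ j) * (y * det n (minor B j))))
                    (eA zero j j≢k) (eB zero j j≢k)))
    where
    k′ = punchOut j≢k
    punchIn-k′ : punchIn j k′ ≡ k
    punchIn-k′ = FP.punchIn-punchOut j≢k
    avoids-k : ∀ l → l ≢ k′ → punchIn j l ≢ k
    avoids-k l l≢k′ e = l≢k′ (FP.punchIn-injective j l k′ (trans e (sym punchIn-k′)))
    minor-linear : det n (minor M j) ≡ a * det n (minor A j) + b * det n (minor B j)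
    minor-linear = det-linear-column n (minor M j) (minor A j) (minor B j) k′ a b
      (λ i l l≢ → eA (suc i) (punchIn j l) (avoids-k l l≢))
      (λ i l l≢ → eB (suc i) (punchIn j l) (avoids-k l l≢))
      (λ i → subst (λ c → M (suc i) c ≡ a * A (suc i) c + b * B (suc i) c) (sym punchIn-k′) (ek (suc i)))

-- Removing column c or column c + 1 leaves the same ordered list of columns,
-- except that the two removed positions trade places.
punchIn-adjacent : ∀ {n} (c k : Fin (suc n)) →
  punchIn (inject₁ c) k ≡ punchIn (suc c) k ⊎ (punchIn (inject₁ c) k ≡ suc c × punchIn (suc c) k ≡ inject₁ c)
punchIn-adjacent zero zero = inj₂ (refl , refl)
punchIn-adjacent zero (suc k) = inj₁ refl
punchIn-adjacent {suc n} (suc c) zero = inj₁ refl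
punchIn-adjacent {suc n} (suc c) (suc k) with punchIn-adjacent c k
... | inj₁ e = inj₁ (cong suc e)
... | inj₂ (e₁ , e₂) = inj₂ (cong suc e₁ , cong suc e₂)

punchIn-avoiding-adjacent : ∀ n (j : Fin (3 ℕ.+ n)) (c : Fin (2 ℕ.+ n)) → j ≢ inject₁ c → j ≢ suc c →
  ∃ λ (c′ : Fin (suc n)) → punchIn j (inject₁ c′) ≡ inject₁ c × punchIn j (suc c′) ≡ suc c
punchIn-avoiding-adjacent n zero zero j≢c j≢c+1 = ⊥-elim (j≢c refl)
punchIn-avoiding-adjacent n zero (suc c) j≢c j≢c+1 = c , refl , refl
punchIn-avoiding-adjacent n (suc zero) zero j≢c j≢c+1 = ⊥-elim (j≢c+1 refl)
punchIn-avoiding-adjacent n (suc (suc j)) zero j≢c j≢c+1 = zero , refl , refl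
punchIn-avoiding-adjacent zero (suc zero) (suc zero) j≢c j≢c+1 = ⊥-elim (j≢c refl)
punchIn-avoiding-adjacent zero (suc (suc zero)) (suc zero) j≢c j≢c+1 = ⊥-elim (j≢c+1 refl)
punchIn-avoiding-adjacent (suc n) (suc j) (suc c) j≢c j≢c+1
  with punchIn-avoiding-adjacent n j c (λ e → j≢c (cong suc e)) (λ e → j≢c+1 (cong suc e))
... | c′ , e₁ , e₂ = suc c′ , cong suc e₁ , cong suc e₂

Σ-supported-on-adjacent : ∀ n (f : Fin (2 ℕ.+ n) → ℤ) (c : Fin (suc n)) →
  (∀ j → j ≢ inject₁ c → j ≢ suc c → f j ≡ + 0) → f (inject₁ c) + f (suc c) ≡ + 0 →
  Σ[<] (2 ℕ.+ n) f ≡ + 0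
Σ-supported-on-adjacent n f zero vanish pair =
  trans (cong (λ t → f zero + (f (suc zero) + t)) (Σ-zero n (λ i → vanish (suc (suc i)) (λ ()) (λ ()))))
        (trans (cong (_+_ (f zero)) (ℤP.+-identityʳ _)) pair)
Σ-supported-on-adjacent (suc n) f (suc c) vanish pair =
  trans (cong (_+ Σ[<] (2 ℕ.+ n) (λ i → f (suc i))) (vanish zero (λ ()) (λ ())))
    (trans (ℤP.+-identityˡ _)
      (Σ-supported-on-adjacent n (λ i → f (suc i)) c
        (λ j ne₁ ne₂ → vanish (suc j) (λ e → ne₁ (FP.suc-injective e)) (λ e → ne₂ (FP.suc-injective e))) pair))

det-adjacent-equal-columns : ∀ n (M : Mat (2 ℕ.+ n)) (c : Fin (suc n)) →
  (∀ i → M i (inject₁ c) ≡ M i (suc c)) → det (2 ℕ.+ n) M ≡ + 0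
det-adjacent-equal-columns n M c same =
  Σ-supported-on-adjacent n (cofactorTerm M) c (others n M c same) cancel
  where
  others : ∀ n (M : Mat (2 ℕ.+ n)) (c : Fin (suc n)) → (∀ i → M i (inject₁ c) ≡ M i (suc c)) →
           ∀ j → j ≢ inject₁ c → j ≢ suc c → cofactorTerm M j ≡ + 0
  others zero M zero same zero ne₁ ne₂ = ⊥-elim (ne₁ refl)
  others zero M zero same (suc zero) ne₁ ne₂ = ⊥-elim (ne₂ refl)
  others (suc n) M c same j ne₁ ne₂ with punchIn-avoiding-adjacent n j c ne₁ ne₂
  ... | c′ , e₁ , e₂ =
    trans (cong (λ d → sign (toℕ j) * (M zero j * d))
            (det-adjacent-equal-columns n (minor M j) c′
              (λ i → subst₂ (λ a b → M (suc i) a ≡ M (suc i) b) (sym e₁) (sym e₂) (same (suc i)))))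
          (trans (cong (sign (toℕ j) *_) (ℤP.*-zeroʳ (M zero j))) (ℤP.*-zeroʳ (sign (toℕ j))))
  same-minors : det (suc n) (minor M (inject₁ c)) ≡ det (suc n) (minor M (suc c))
  same-minors = det-cong (suc n) λ i k → columns i k (punchIn-adjacent c k)
    where
    columns : ∀ i k → _ → M (suc i) (punchIn (inject₁ c) k) ≡ M (suc i) (punchIn (suc c) k)
    columns i k (inj₁ e) = cong (M (suc i)) e
    columns i k (inj₂ (e₁ , e₂)) =
      trans (cong (M (suc i)) e₁) (trans (sym (same (suc i))) (cong (M (suc i)) (sym e₂)))
  opposite : ∀ s x d → s * (x * d) + (- s) * (x * d) ≡ + 0
  opposite = solve-∀
  cancel : cofactorTerm M (inject₁ c) + cofactorTerm M (suc c) ≡ + 0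
  cancel =
    trans (cong₂ _+_ (cong₂ _*_ (cong sign (FP.toℕ-inject₁ c)) (cong₂ _*_ (same zero) same-minors))
                     (cong (_* (M zero (suc c) * det (suc n) (minor M (suc c)))) (sign-suc (toℕ c))))
          (opposite (sign (toℕ c)) (M zero (suc c)) (det (suc n) (minor M (suc c))))

swap : ∀ {n} → Fin n → Fin n → Fin n → Fin n
swap p q j with j F.≟ p | j F.≟ q
... | yes _ | _ = q
... | no _ | yes _ = p
... | no _ | no _ = j

swap-left : ∀ {n} (p q : Fin n) → swap p q p ≡ q
swap-left p q with p F.≟ p
... | yes _ = refl
... | no p≢p = ⊥-elim (p≢p refl)

swap-right : ∀ {n} (p q : Fin n) → q ≢ p → swap p q q ≡ p
swap-right p q q≢p with q F.≟ p | q F.≟ q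
... | yes e | _ = ⊥-elim (q≢p e)
... | no _ | yes _ = refl
... | no _ | no q≢q = ⊥-elim (q≢q refl)

swap-other : ∀ {n} (p q j : Fin n) → j ≢ p → j ≢ q → swap p q j ≡ j
swap-other p q j j≢p j≢q with j F.≟ p | j F.≟ q
... | yes e | _ = ⊥-elim (j≢p e)
... | no _ | yes e = ⊥-elim (j≢q e)
... | no _ | no _ = refl

replaceColumns : ∀ {n} → Mat n → Fin n → Fin n → (Fin n → ℤ) → (Fin n → ℤ) → Mat n
replaceColumns M p q u v i j with j F.≟ p | j F.≟ q
... | yes _ | _ = u i
... | no _ | yes _ = v i
... | no _ | no _ = M i j

module _ {n} (M : Mat n) (p q : Fin n) (p≢q : p ≢ q) where
  private
    W = replaceColumns M p q

    W-at-p : ∀ u v i → W u v i p ≡ u i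
    W-at-p u v i with p F.≟ p
    ... | yes _ = refl
    ... | no p≢p = ⊥-elim (p≢p refl)

    W-at-q : ∀ u v i → W u v i q ≡ v i
    W-at-q u v i with q F.≟ p | q F.≟ q
    ... | yes e | _ = ⊥-elim (p≢q (sym e))
    ... | no _ | yes _ = refl
    ... | no _ | no q≢q = ⊥-elim (q≢q refl)

    W-off-p : ∀ u u′ v i j → j ≢ p → W u v i j ≡ W u′ v i j
    W-off-p u u′ v i j j≢p with j F.≟ p | j F.≟ q
    ... | yes e | _ = ⊥-elim (j≢p e)
    ... | no _ | yes _ = refl
    ... | no _ | no _ = refl

    W-off-q : ∀ u v v′ i j → j ≢ q → W u v i j ≡ W u v′ i j
    W-off-q u v v′ i j j≢q with j F.≟ p | j F.≟ q
    ... | yes _ | _ = refl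
    ... | no _ | yes e = ⊥-elim (j≢q e)
    ... | no _ | no _ = refl

    W-id : ∀ i j → W (λ i → M i p) (λ i → M i q) i j ≡ M i j
    W-id i j with j F.≟ p | j F.≟ q
    ... | yes refl | _ = refl
    ... | no _ | yes refl = refl
    ... | no _ | no _ = refl

    W-swap : ∀ i j → W (λ i → M i q) (λ i → M i p) i j ≡ M i (swap p q j)
    W-swap i j with j F.≟ p | j F.≟ q
    ... | yes refl | _ = refl
    ... | no _ | yes refl = refl
    ... | no _ | no _ = refl

    as-combination : ∀ {x y z : ℤ} → z ≡ x + y → z ≡ + 1 * x + + 1 * y
    as-combination {x} {y} e = trans e (sym (cong₂ _+_ (ℤP.*-identityˡ x) (ℤP.*-identityˡ y)))

    det-additive-p : ∀ u₁ u₂ v → det n (W (λ i → u₁ i + u₂ i) v) ≡ det n (W u₁ v) + det n (W u₂ v)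
    det-additive-p u₁ u₂ v =
      trans (det-linear-column n (W (λ i → u₁ i + u₂ i) v) (W u₁ v) (W u₂ v) p (+ 1) (+ 1) (W-off-p _ u₁ v) (W-off-p _ u₂ v)
              (λ i → trans (W-at-p _ v i) (as-combination {W u₁ v i p} {W u₂ v i p} (sym (cong₂ _+_ (W-at-p u₁ v i) (W-at-p u₂ v i))))))
            (cong₂ _+_ (ℤP.*-identityˡ (det n (W u₁ v))) (ℤP.*-identityˡ (det n (W u₂ v))))

    det-additive-q : ∀ u v₁ v₂ → det n (W u (λ i → v₁ i + v₂ i)) ≡ det n (W u v₁) + det n (W u v₂)
    det-additive-q u v₁ v₂ =
      trans (det-linear-column n (W u (λ i → v₁ i + v₂ i)) (W u v₁) (W u v₂) q (+ 1) (+ 1) (W-off-q u _ v₁) (W-off-q u _ v₂)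
              (λ i → trans (W-at-q u _ i) (as-combination {W u v₁ i q} {W u v₂ i q} (sym (cong₂ _+_ (W-at-q u v₁ i) (W-at-q u v₂ i))))))
            (cong₂ _+_ (ℤP.*-identityˡ (det n (W u v₁))) (ℤP.*-identityˡ (det n (W u v₂))))

  Alternating : Set
  Alternating = ∀ M′ → (∀ i → M′ i p ≡ M′ i q) → det n M′ ≡ + 0

  det-swap-columns : Alternating → det n (λ i j → M i (swap p q j)) ≡ - det n M
  det-swap-columns alt = sum-zero⇒neg (begin
    + 0                                                              ≡⟨ sym (alt _ (equal (λ i → a i + b i))) ⟩
    det n (W (λ i → a i + b i) (λ i → a i + b i))                    ≡⟨ det-additive-p a b _ ⟩
    det n (W a (λ i → a i + b i)) + det n (W b (λ i → a i + b i))    ≡⟨ cong₂ _+_ (det-additive-q a a b) (det-additive-q b a b) ⟩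
    (det n (W a a) + det n (W a b)) + (det n (W b a) + det n (W b b))
      ≡⟨ cong₂ _+_ (cong₂ _+_ (alt _ (equal a)) (det-cong n W-id)) (cong₂ _+_ (det-cong n W-swap) (alt _ (equal b))) ⟩
    (+ 0 + det n M) + (det n (λ i j → M i (swap p q j)) + + 0)        ∎)
    where
    open ≡-Reasoning
    a b : Fin n → ℤ
    a i = M i p
    b i = M i q
    equal : ∀ w i → W w w i p ≡ W w w i q
    equal w i = trans (W-at-p w w i) (sym (W-at-q w w i))
    sum-zero⇒neg : ∀ {x y} → + 0 ≡ (+ 0 + x) + (y + + 0) → y ≡ - x
    sum-zero⇒neg {x} {y} e = trans (sym (solve x y)) (trans (cong (_+ - x) (sym e)) (ℤP.+-identityˡ (- x)))
      where solve : ∀ x y → (+ 0 + x) + (y + + 0) + - x ≡ y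
            solve = solve-∀

adjacent-from-toℕ : ∀ {n} (r q : Fin (2 ℕ.+ n)) → toℕ q ≡ suc (toℕ r) →
                    ∃ λ (c : Fin (suc n)) → r ≡ inject₁ c × q ≡ suc c
adjacent-from-toℕ zero (suc zero) e = zero , refl , refl
adjacent-from-toℕ {suc n} (suc r) (suc q) e with adjacent-from-toℕ r q (ℕP.suc-injective e)
... | c , refl , refl = suc c , refl , refl
adjacent-from-toℕ {zero} (suc zero) (suc zero) ()

det-equal-consecutive-columns : ∀ n (M : Mat n) r q → toℕ q ≡ suc (toℕ r) → (∀ i → M i r ≡ M i q) → det n M ≡ + 0
det-equal-consecutive-columns (suc zero) M zero zero () same
det-equal-consecutive-columns (suc (suc n)) M r q e same with adjacent-from-toℕ r q e
... | c , refl , refl = det-adjacent-equal-columns n M c same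

-- Induction on the distance between the two equal columns: swapping column q
-- with its left neighbour brings them closer and only flips the sign.
det-equal-columns-at-distance : ∀ d n (M : Mat n) p q → suc (toℕ p ℕ.+ d) ≡ toℕ q →
                                (∀ i → M i p ≡ M i q) → det n M ≡ + 0
det-equal-columns-at-distance zero n M p q e same =
  det-equal-consecutive-columns n M p q (trans (sym e) (cong suc (ℕP.+-identityʳ (toℕ p)))) same
det-equal-columns-at-distance (suc d) (suc n) M p (suc q₀) e same =
  trans (sym (ℤP.neg-involutive _)) (cong -_ (trans (sym swapped-det) swapped-zero))
  where
  r = inject₁ q₀
  q = suc q₀
  toℕ-r : toℕ r ≡ toℕ q₀
  toℕ-r = FP.toℕ-inject₁ q₀
  r-dist : suc (toℕ p ℕ.+ d) ≡ toℕ r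
  r-dist = trans (sym (ℕP.+-suc (toℕ p) d)) (trans (ℕP.suc-injective e) (sym toℕ-r))
  ≢-by-distance : ∀ {a b : Fin (suc n)} k → suc (toℕ a ℕ.+ k) ≡ toℕ b → a ≢ b
  ≢-by-distance {a} k dist refl = ℕP.m≢1+m+n (toℕ a) (sym dist)
  M′ : Mat (suc n)
  M′ i j = M i (swap r q j)
  swapped-det : det (suc n) M′ ≡ - det (suc n) M
  swapped-det = det-swap-columns M r q (≢-by-distance 0 (cong suc (trans (ℕP.+-identityʳ _) toℕ-r)))
    (λ K same′ → det-equal-consecutive-columns (suc n) K r q (cong suc (sym toℕ-r)) same′)
  swapped-zero : det (suc n) M′ ≡ + 0
  swapped-zero = det-equal-columns-at-distance d (suc n) M′ p r r-dist
    (λ i → trans (cong (M i) (swap-other r q p (≢-by-distance d r-dist) (≢-by-distance (suc d) e)))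
                 (trans (same i) (cong (M i) (sym (swap-left r q)))))

det-equal-columns : ∀ n (M : Mat n) p q → p ≢ q → (∀ i → M i p ≡ M i q) → det n M ≡ + 0
det-equal-columns n M p q p≢q same with ℕP.<-cmp (toℕ p) (toℕ q)
... | tri< p<q _ _ = det-equal-columns-at-distance _ n M p q (ℕP.m+[n∸m]≡n p<q) same
... | tri≈ _ e _ = ⊥-elim (p≢q (FP.toℕ-injective e))
... | tri> _ _ q<p = det-equal-columns-at-distance _ n M q p (ℕP.m+[n∸m]≡n q<p) (λ i → sym (same i))

setColumn : ∀ {n} → Mat n → Fin n → (Fin n → ℤ) → Mat n
setColumn M k v i j with j F.≟ k
... | yes _ = v i
... | no _ = M i j

setColumn-≡ : ∀ {n} (M : Mat n) k v i → setColumn M k v i k ≡ v i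
setColumn-≡ M k v i with k F.≟ k
... | yes _ = refl
... | no k≢k = ⊥-elim (k≢k refl)

setColumn-≢ : ∀ {n} (M : Mat n) k v i j → j ≢ k → setColumn M k v i j ≡ M i j
setColumn-≢ M k v i j j≢k with j F.≟ k
... | yes e = ⊥-elim (j≢k e)
... | no _ = refl

det-add-column-multiple : ∀ n (M M′ : Mat n) (k l : Fin n) (t : ℤ) → k ≢ l →
  (∀ i j → j ≢ k → M′ i j ≡ M i j) → (∀ i → M′ i k ≡ M i k + t * M i l) → det n M′ ≡ det n M
det-add-column-multiple n M M′ k l t k≢l same added =
  trans (det-linear-column n M′ M K k (+ 1) t same (λ i j j≢k → trans (same i j j≢k) (sym (setColumn-≢ M k l-th i j j≢k)))
          (λ i → trans (added i) (cong₂ _+_ (sym (ℤP.*-identityˡ (M i k))) (cong (t *_) (sym (setColumn-≡ M k l-th i))))))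
        (trans (cong₂ _+_ (ℤP.*-identityˡ (det n M)) (trans (cong (t *_) K-singular) (ℤP.*-zeroʳ t))) (ℤP.+-identityʳ _))
  where
  l-th : Fin n → ℤ
  l-th i = M i l
  K = setColumn M k l-th
  K-singular : det n K ≡ + 0
  K-singular = det-equal-columns n K k l k≢l (λ i → trans (setColumn-≡ M k l-th i) (sym (setColumn-≢ M k l-th i l (λ e → k≢l (sym e)))))

x+0*y≡x : ∀ x y → x + + 0 * y ≡ x
x+0*y≡x x y = trans (cong (_+_ x) (ℤP.*-zeroˡ y)) (ℤP.+-identityʳ x)

restrict : ∀ {n} → (Fin n → ℤ) → ℕ → Fin n → ℤ
restrict t m j with toℕ j ℕ.<? m
... | yes _ = t j
... | no _ = + 0

restrict-≢ : ∀ {n} (t : Fin n → ℤ) m j → toℕ j ≢ m → restrict t (suc m) j ≡ restrict t m j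
restrict-≢ t m j j≢m with toℕ j ℕ.<? suc m | toℕ j ℕ.<? m
... | yes _ | yes _ = refl
... | no _ | no _ = refl
... | yes j<1+m | no j≮m = ⊥-elim (j≮m (ℕP.≤∧≢⇒< (ℕP.≤-pred j<1+m) j≢m))
... | no j≮1+m | yes j<m = ⊥-elim (j≮1+m (ℕP.m<n⇒m<1+n j<m))

restrict-added : ∀ {n} (t : Fin n → ℤ) m j → toℕ j ≡ m → restrict t (suc m) j ≡ t j
restrict-added t m j j≡m with toℕ j ℕ.<? suc m
... | yes _ = refl
... | no j≮1+m = ⊥-elim (j≮1+m (ℕ.s≤s (ℕP.≤-reflexive j≡m)))

restrict-not-yet : ∀ {n} (t : Fin n → ℤ) m j → toℕ j ≡ m → restrict t m j ≡ + 0
restrict-not-yet t m j j≡m with toℕ j ℕ.<? m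
... | yes j<m = ⊥-elim (ℕP.<-irrefl j≡m j<m)
... | no _ = refl

restrict-all : ∀ {n} (t : Fin n → ℤ) j → restrict t n j ≡ t j
restrict-all {n} t j with toℕ j ℕ.<? n
... | yes _ = refl
... | no j≮n = ⊥-elim (j≮n (FP.toℕ<n j))

restrict-either : ∀ {n} (t : Fin n → ℤ) m j → restrict t m j ≡ t j ⊎ restrict t m j ≡ + 0
restrict-either t m j with toℕ j ℕ.<? m
... | yes _ = inj₁ refl
... | no _ = inj₂ refl

-- The side condition says that no column that is changed is itself added to
-- another one, so the operations can be performed one column at a time.
det-add-column-multiples : ∀ n (M : Mat n) (σ : Fin n → Fin n) (t : Fin n → ℤ) →
  (∀ j → t j ≡ + 0 ⊎ (σ j ≢ j × t (σ j) ≡ + 0)) →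
  det n (λ i j → M i j + t j * M i (σ j)) ≡ det n M
det-add-column-multiples n M σ t ok =
  trans (det-cong n (λ i j → cong (λ c → M i j + c * M i (σ j)) (sym (restrict-all t j))))
        (trans (first n) (det-cong n (λ i j → x+0*y≡x (M i j) (M i (σ j)))))
  where
  after : ℕ → Mat n
  after m i j = M i j + restrict t m j * M i (σ j)
  source-unchanged : ∀ m j → t (σ j) ≡ + 0 → ∀ i → after m i (σ j) ≡ M i (σ j)
  source-unchanged m j t-σj≡0 i with restrict-either t m (σ j)
  ... | inj₁ e = trans (cong (λ c → M i (σ j) + c * M i (σ (σ j))) (trans e t-σj≡0)) (x+0*y≡x (M i (σ j)) (M i (σ (σ j))))
  ... | inj₂ e = trans (cong (λ c → M i (σ j) + c * M i (σ (σ j))) e) (x+0*y≡x (M i (σ j)) (M i (σ (σ j))))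
  step : ∀ m → det n (after (suc m)) ≡ det n (after m)
  step m with m ℕ.<? n
  ... | no m≮n = det-cong n (λ i j → cong (λ c → M i j + c * M i (σ j))
                   (restrict-≢ t m j (λ e → ℕP.<-irrefl e (ℕP.<-≤-trans (FP.toℕ<n j) (ℕP.≮⇒≥ m≮n)))))
  ... | yes m<n with ok (F.fromℕ< m<n)
  ...   | inj₁ t-k≡0 = det-cong n (λ i j → cong (λ c → M i j + c * M i (σ j)) (unchanged j))
    where
    unchanged : ∀ j → restrict t (suc m) j ≡ restrict t m j
    unchanged j with toℕ j ℕ.≟ m
    ... | no j≢m = restrict-≢ t m j j≢m
    ... | yes j≡m = trans (restrict-added t m j j≡m)
                      (trans (trans (cong t (FP.toℕ-injective (trans j≡m (sym (FP.toℕ-fromℕ< m<n))))) t-k≡0)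
                             (sym (restrict-not-yet t m j j≡m)))
  ...   | inj₂ (σk≢k , t-σk≡0) =
    det-add-column-multiple n (after m) (after (suc m)) k (σ k) (t k) (λ e → σk≢k (sym e))
      (λ i j j≢k → cong (λ c → M i j + c * M i (σ j))
                        (restrict-≢ t m j (λ e → j≢k (FP.toℕ-injective (trans e (sym (FP.toℕ-fromℕ< m<n)))))))
      (λ i → trans (cong (λ c → M i k + c * M i (σ k)) (restrict-added t m k (FP.toℕ-fromℕ< m<n)))
               (sym (trans (cong₂ (λ c d → (M i k + c * M i (σ k)) + t k * d)
                                  (restrict-not-yet t m k (FP.toℕ-fromℕ< m<n)) (source-unchanged m k t-σk≡0 i))
                           (cong (_+ t k * M i (σ k)) (x+0*y≡x (M i k) (M i (σ k)))))))
    where k = F.fromℕ< m<n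
  first : ∀ m → det n (after m) ≡ det n (after 0)
  first zero    = refl
  first (suc m) = trans (step m) (first m)

det-expand-first-column : ∀ n (M : Mat (suc n)) →
  det (suc n) M ≡ Σ[<] (suc n) (λ r → sign (toℕ r) * (M r zero * det n (λ i k → M (punchIn r i) (suc k))))
det-expand-first-column zero    M = refl
det-expand-first-column (suc n) M = cong (_+_ (cofactorTerm M zero)) (begin
  Σ[<] (suc n) (λ j → sign (suc (toℕ j)) * (M zero (suc j) * det (suc n) (minor M (suc j))))
    ≡⟨ Σ-cong (suc n) (λ j → cong (λ d → sign (suc (toℕ j)) * (M zero (suc j) * d))
                                   (det-expand-first-column n (minor M (suc j)))) ⟩
  Σ[<] (suc n) (λ j → sign (suc (toℕ j)) * (M zero (suc j) * Σ[<] (suc n) (λ r → sign (toℕ r) * (M (suc r) zero * D r j))))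
    ≡⟨ Σ-cong (suc n) (λ j → sym (Σ-*ˡ² (sign (suc (toℕ j))) (M zero (suc j)) (λ r → sign (toℕ r) * (M (suc r) zero * D r j)))) ⟩
  Σ[<] (suc n) (λ j → Σ[<] (suc n) (λ r → term r j))
    ≡⟨ Σ-comm (suc n) (suc n) (λ j r → term r j) ⟩
  Σ[<] (suc n) (λ r → Σ[<] (suc n) (λ j → term r j))
    ≡⟨ Σ-cong (suc n) (λ r → trans (Σ-cong (suc n) (term-symmetric r))
                                    (Σ-*ˡ² (sign (suc (toℕ r))) (M (suc r) zero) (λ j → sign (toℕ j) * (M zero (suc j) * D r j)))) ⟩
  Σ[<] (suc n) (λ r → sign (suc (toℕ r)) * (M (suc r) zero * Σ[<] (suc n) (λ j → sign (toℕ j) * (M zero (suc j) * D r j)))) ∎)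
  where
  open ≡-Reasoning
  Σ-*ˡ² : ∀ x y (f : Fin (suc n) → ℤ) → Σ[<] (suc n) (λ r → x * (y * f r)) ≡ x * (y * Σ[<] (suc n) f)
  Σ-*ˡ² x y f = trans (Σ-*ˡ (suc n) x (λ r → y * f r)) (cong (x *_) (Σ-*ˡ (suc n) y f))
  D : Fin (suc n) → Fin (suc n) → ℤ
  D r j = det n (λ i k → M (suc (punchIn r i)) (suc (punchIn j k)))
  term : Fin (suc n) → Fin (suc n) → ℤ
  term r j = sign (suc (toℕ j)) * (M zero (suc j) * (sign (toℕ r) * (M (suc r) zero * D r j)))
  exchange : ∀ sj sr a b d → (- sj) * (a * (sr * (b * d))) ≡ (- sr) * (b * (sj * (a * d)))
  exchange = solve-∀
  term-symmetric : ∀ r j → term r j ≡ sign (suc (toℕ r)) * (M (suc r) zero * (sign (toℕ j) * (M zero (suc j) * D r j)))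
  term-symmetric r j =
    trans (cong (λ s → s * (M zero (suc j) * (sign (toℕ r) * (M (suc r) zero * D r j)))) (sign-suc (toℕ j)))
      (trans (exchange (sign (toℕ j)) (sign (toℕ r)) (M zero (suc j)) (M (suc r) zero) (D r j))
             (cong (λ s → s * (M (suc r) zero * (sign (toℕ j) * (M zero (suc j) * D r j)))) (sym (sign-suc (toℕ r)))))

det-transpose : ∀ n (M : Mat n) → det n (λ i j → M j i) ≡ det n M
det-transpose zero    M = refl
det-transpose (suc n) M =
  trans (Σ-cong (suc n) (λ j → cong (λ d → sign (toℕ j) * (M j zero * d)) (det-transpose n (λ i k → M (punchIn j i) (suc k)))))
        (sym (det-expand-first-column n M))

det-add-row-multiples : ∀ n (M : Mat n) (σ : Fin n → Fin n) (t : Fin n → ℤ) →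
  (∀ i → t i ≡ + 0 ⊎ (σ i ≢ i × t (σ i) ≡ + 0)) →
  det n (λ i j → M i j + t i * M (σ i) j) ≡ det n M
det-add-row-multiples n M σ t ok =
  trans (sym (det-transpose n _)) (trans (det-add-column-multiples n (λ i j → M j i) σ t ok) (det-transpose n M))

punchIn-↑ʳ : ∀ m n (j : Fin (suc m)) (k : Fin n) → punchIn (j ↑ˡ n) (m ↑ʳ k) ≡ suc m ↑ʳ k
punchIn-↑ʳ m       n zero    k = refl
punchIn-↑ʳ (suc m) n (suc j) k = cong suc (punchIn-↑ʳ m n j k)

punchIn-↑ˡ : ∀ m n (j : Fin (suc m)) (k : Fin m) → punchIn (j ↑ˡ n) (k ↑ˡ n) ≡ punchIn j k ↑ˡ n
punchIn-↑ˡ m       n zero    k       = refl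
punchIn-↑ˡ (suc m) n (suc j) zero    = refl
punchIn-↑ˡ (suc m) n (suc j) (suc k) = cong suc (punchIn-↑ˡ m n j k)

det-block-triangular : ∀ m n (M : Mat (m ℕ.+ n)) → (∀ i j → M (i ↑ˡ n) (m ↑ʳ j) ≡ + 0) →
  det (m ℕ.+ n) M ≡ det m (λ i j → M (i ↑ˡ n) (j ↑ˡ n)) * det n (λ i j → M (m ↑ʳ i) (m ↑ʳ j))
det-block-triangular zero    n M zero-block = sym (ℤP.*-identityˡ _)
det-block-triangular (suc m) n M zero-block =
  trans (Σ-↑ (suc m) n (cofactorTerm M))
    (trans (cong₂ _+_ (Σ-cong (suc m) left-term) (Σ-zero n right-term))
      (trans (ℤP.+-identityʳ _) (Σ-*ʳ (suc m) bottom (cofactorTerm top))))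
  where
  top : Mat (suc m)
  top i j = M (i ↑ˡ n) (j ↑ˡ n)
  bottom = det n (λ i j → M (suc m ↑ʳ i) (suc m ↑ʳ j))
  right-term : ∀ j → cofactorTerm M (suc m ↑ʳ j) ≡ + 0
  right-term j = trans (cong (λ x → s * (x * d)) (zero-block zero j))
                       (trans (cong (s *_) (ℤP.*-zeroˡ d)) (ℤP.*-zeroʳ s))
    where
    s = sign (toℕ (suc m ↑ʳ j))
    d = det (m ℕ.+ n) (minor M (suc m ↑ʳ j))
  reassociate : ∀ s a b c → s * (a * (b * c)) ≡ (s * (a * b)) * c
  reassociate = solve-∀
  left-term : ∀ j → cofactorTerm M (j ↑ˡ n) ≡ cofactorTerm top j * bottom
  left-term j =
    trans (cong₂ (λ s d → s * (M zero (j ↑ˡ n) * d)) (cong sign (FP.toℕ-↑ˡ j n))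
            (trans (det-block-triangular m n (minor M (j ↑ˡ n))
                     (λ i k → trans (cong (M (suc (i ↑ˡ n))) (punchIn-↑ʳ m n j k)) (zero-block (suc i) k)))
                   (cong₂ _*_ (det-cong m (λ i k → cong (M (suc (i ↑ˡ n))) (punchIn-↑ˡ m n j k)))
                              (det-cong n (λ i k → cong (M (suc (m ↑ʳ i))) (punchIn-↑ʳ m n j k))))))
          (reassociate (sign (toℕ j)) (top zero j) (det m (minor top j)) bottom)

det-swap-conjugate : ∀ n (M : Mat n) p q → p ≢ q → det n (λ i j → M (swap p q i) (swap p q j)) ≡ det n M
det-swap-conjugate n M p q p≢q =
  trans (det-swap-columns (λ i j → M (swap p q i) j) p q p≢q (λ K → det-equal-columns n K p q p≢q))
    (trans (cong -_ (trans (sym (det-transpose n (λ i j → M (swap p q i) j)))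
                           (det-swap-columns (λ i j → M j i) p q p≢q (λ K → det-equal-columns n K p q p≢q))))
           (trans (ℤP.neg-involutive _) (det-transpose n M)))

det-1 : ∀ (M : Mat 1) → det 1 M ≡ M zero zero
det-1 M = trans (ℤP.+-identityʳ _) (trans (ℤP.*-identityˡ _) (ℤP.*-identityʳ (M zero zero)))

-- Determinants of matrices indexed by lists

det-cast : ∀ {m n} (e : m ≡ n) (M : Mat n) → det n M ≡ det m (λ i j → M (cast e i) (cast e j))
det-cast refl M = det-cong _ (λ i j → sym (cong₂ M (FP.cast-is-id refl i) (FP.cast-is-id refl j)))

map-as-tabulate : ∀ {A B : Set} (f : A → B) (xs : List A) → map f xs ≡ tabulate (λ i → f (lookup xs i))
map-as-tabulate f xs = trans (cong (map f) (sym (LP.tabulate-lookup xs))) (LP.map-tabulate (lookup xs) f)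

tabulate-++ : ∀ {A : Set} {m n} (f : Fin m → A) (g : Fin n → A) →
              tabulate f ++ tabulate g ≡ tabulate (λ k → [ f , g ]′ (splitAt m k))
tabulate-++ {m = zero}  f g = refl
tabulate-++ {m = suc m} f g = cong (f zero ∷_) (trans (tabulate-++ (λ i → f (suc i)) g) (LP.tabulate-cong shift))
  where
  shift : ∀ k → [ (λ i → f (suc i)) , g ]′ (splitAt m k) ≡ [ f , g ]′ (splitAt (suc m) (suc k))
  shift k with splitAt m k
  ... | inj₁ _ = refl
  ... | inj₂ _ = refl

swap-suc : ∀ {n} (p q i : Fin n) → p ≢ q → swap (suc p) (suc q) (suc i) ≡ suc (swap p q i)
swap-suc p q i p≢q = by-cases (i F.≟ p) (i F.≟ q)
  where
  by-cases : Dec (i ≡ p) → Dec (i ≡ q) → swap (suc p) (suc q) (suc i) ≡ suc (swap p q i)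
  by-cases (yes refl) _ = trans (swap-left (suc p) (suc q)) (cong suc (sym (swap-left p q)))
  by-cases (no i≢p) (yes refl) =
    trans (swap-right (suc p) (suc i) (λ e → i≢p (FP.suc-injective e))) (cong suc (sym (swap-right p i i≢p)))
  by-cases (no i≢p) (no i≢q) =
    trans (swap-other (suc p) (suc q) (suc i) (λ e → i≢p (FP.suc-injective e)) (λ e → i≢q (FP.suc-injective e)))
            (cong suc (sym (swap-other p q i i≢p i≢q)))

module _ {X : Set} where

  position₁ position₂ : ∀ (pre : List X) x y zs → Fin (length (pre ++ x ∷ y ∷ zs))
  position₁ []        x y zs = zero
  position₁ (_ ∷ pre) x y zs = suc (position₁ pre x y zs)
  position₂ []        x y zs = suc zero
  position₂ (_ ∷ pre) x y zs = suc (position₂ pre x y zs)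

  position₁≢position₂ : ∀ (pre : List X) x y zs → position₁ pre x y zs ≢ position₂ pre x y zs
  position₁≢position₂ []        x y zs ()
  position₁≢position₂ (_ ∷ pre) x y zs e = position₁≢position₂ pre x y zs (FP.suc-injective e)

  length-swap : ∀ (pre : List X) x y zs → length (pre ++ x ∷ y ∷ zs) ≡ length (pre ++ y ∷ x ∷ zs)
  length-swap []        x y zs = refl
  length-swap (_ ∷ pre) x y zs = cong suc (length-swap pre x y zs)

  lookup-swap : ∀ (pre : List X) x y zs (i : Fin (length (pre ++ x ∷ y ∷ zs))) →
                lookup (pre ++ y ∷ x ∷ zs) (cast (length-swap pre x y zs) i)
                  ≡ lookup (pre ++ x ∷ y ∷ zs) (swap (position₁ pre x y zs) (position₂ pre x y zs) i)
  lookup-swap [] x y zs zero = cong (lookup (x ∷ y ∷ zs)) (sym (swap-left {suc (suc (length zs))} zero (suc zero)))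
  lookup-swap [] x y zs (suc zero) =
    cong (lookup (x ∷ y ∷ zs)) (sym (swap-right {suc (suc (length zs))} zero (suc zero) (λ ())))
  lookup-swap [] x y zs (suc (suc k)) =
    trans (cong (λ t → lookup zs t) (FP.cast-is-id refl k))
            (cong (lookup (x ∷ y ∷ zs)) (sym (swap-other {suc (suc (length zs))} zero (suc zero) (suc (suc k)) (λ ()) (λ ()))))
  lookup-swap (a ∷ pre) x y zs zero =
    cong (lookup (a ∷ pre ++ x ∷ y ∷ zs)) (sym (swap-other (suc (position₁ pre x y zs)) (suc (position₂ pre x y zs)) zero (λ ()) (λ ())))
  lookup-swap (a ∷ pre) x y zs (suc i) =
    trans (lookup-swap pre x y zs i)
            (cong (lookup (a ∷ pre ++ x ∷ y ∷ zs))
                  (sym (swap-suc (position₁ pre x y zs) (position₂ pre x y zs) i (position₁≢position₂ pre x y zs))))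


-- Opaque, so that comparing two such determinants never unfolds the Laplace
-- expansion.
opaque
  detOn : ∀ {X : Set} → (X → X → ℤ) → List X → ℤ
  detOn F xs = det (length xs) (λ i j → F (lookup xs i) (lookup xs j))

opaque
  unfolding detOn

  detOn-as-det : ∀ {X : Set} (F : X → X → ℤ) xs → detOn F xs ≡ det (length xs) (λ i j → F (lookup xs i) (lookup xs j))
  detOn-as-det F xs = refl

  detOn-cong : ∀ {X : Set} {F G : X → X → ℤ} xs → (∀ a b → F a b ≡ G a b) → detOn F xs ≡ detOn G xs
  detOn-cong xs e = det-cong (length xs) (λ i j → e _ _)

  detOn-tabulate : ∀ {X : Set} (F : X → X → ℤ) {n} (f : Fin n → X) → detOn F (tabulate f) ≡ det n (λ i j → F (f i) (f j))
  detOn-tabulate F f = trans (det-cast (sym (LP.length-tabulate f)) _)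
                               (det-cong _ (λ i j → cong₂ F (LP.lookup-tabulate f i) (LP.lookup-tabulate f j)))

  detOn-map : ∀ {X Y : Set} (F : X → X → ℤ) (f : Y → X) (ys : List Y) →
              detOn F (map f ys) ≡ detOn (λ a b → F (f a) (f b)) ys
  detOn-map F f ys = trans (cong (detOn F) (map-as-tabulate f ys)) (detOn-tabulate F (λ i → f (lookup ys i)))

  detOn-transpose : ∀ {X : Set} (F : X → X → ℤ) xs → detOn (λ a b → F b a) xs ≡ detOn F xs
  detOn-transpose F xs = det-transpose (length xs) (λ i j → F (lookup xs i) (lookup xs j))

  detOn-swap : ∀ {X : Set} (F : X → X → ℤ) (pre : List X) x y zs → detOn F (pre ++ x ∷ y ∷ zs) ≡ detOn F (pre ++ y ∷ x ∷ zs)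
  detOn-swap F pre x y zs =
    sym (trans (det-cast (length-swap pre x y zs) (λ i j → F (lookup (pre ++ y ∷ x ∷ zs) i) (lookup (pre ++ y ∷ x ∷ zs) j)))
      (trans (det-cong _ (λ i j → cong₂ F (lookup-swap pre x y zs i) (lookup-swap pre x y zs j)))
               (det-swap-conjugate _ (λ i j → F (lookup (pre ++ x ∷ y ∷ zs) i) (lookup (pre ++ x ∷ y ∷ zs) j)) _ _
                                   (position₁≢position₂ pre x y zs))))

module _ {X : Set} where

  detOn-↭-after : ∀ {xs ys : List X} → xs ↭ ys → ∀ (pre : List X) F → detOn F (pre ++ xs) ≡ detOn F (pre ++ ys)
  detOn-↭-after Perm.refl pre F = refl
  detOn-↭-after (Perm.prep x p) pre F =
    trans (cong (detOn F) (sym (LP.++-assoc pre [ x ] _)))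
      (trans (detOn-↭-after p (pre ++ [ x ]) F) (cong (detOn F) (LP.++-assoc pre [ x ] _)))
  detOn-↭-after (Perm.swap x y p) pre F =
    trans (detOn-swap F pre x y _)
      (trans (cong (detOn F) (sym (LP.++-assoc pre (y ∷ x ∷ []) _)))
        (trans (detOn-↭-after p (pre ++ y ∷ x ∷ []) F) (cong (detOn F) (LP.++-assoc pre (y ∷ x ∷ []) _))))
  detOn-↭-after (Perm.trans p q) pre F = trans (detOn-↭-after p pre F) (detOn-↭-after q pre F)

  detOn-↭ : ∀ (F : X → X → ℤ) {xs ys : List X} → xs ↭ ys → detOn F xs ≡ detOn F ys
  detOn-↭ F p = detOn-↭-after p [] F

-- Peeling off a repeated block

data Split (m n : ℕ) : Fin (m ℕ.+ n) → Set where
  left  : (i : Fin m) → Split m n (i ↑ˡ n)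
  right : (j : Fin n) → Split m n (m ↑ʳ j)

split : ∀ m n (i : Fin (m ℕ.+ n)) → Split m n i
split m n i with splitAt m i in eq
... | inj₁ a = subst (Split m n) (FP.splitAt⁻¹-↑ˡ eq) (left a)
... | inj₂ b = subst (Split m n) (FP.splitAt⁻¹-↑ʳ eq) (right b)

↑ˡ≢↑ʳ : ∀ m n (i : Fin m) (j : Fin n) → i ↑ˡ n ≢ m ↑ʳ j
↑ˡ≢↑ʳ m n i j e with trans (sym (FP.splitAt-↑ˡ m i n)) (trans (cong (splitAt m) e) (FP.splitAt-↑ʳ m n j))
... | ()

-- Indices arranged in three consecutive blocks: a first copy e₀ of some h
-- indices, r further indices, and a second copy eₘ of the h indices.
module _ {X : Set} (h r : ℕ) (e₀ eₘ : Fin h → X) (mid : Fin r → X) where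

  top : Fin (h ℕ.+ r) → X
  top i = [ e₀ , mid ]′ (splitAt h i)

  blocks : Fin ((h ℕ.+ r) ℕ.+ h) → X
  blocks i = [ top , eₘ ]′ (splitAt (h ℕ.+ r) i)

  private
    n = (h ℕ.+ r) ℕ.+ h

    first : Fin h → Fin n
    first z = (z ↑ˡ r) ↑ˡ h
    middle : Fin r → Fin n
    middle k = (h ↑ʳ k) ↑ˡ h
    last : Fin h → Fin n
    last z = (h ℕ.+ r) ↑ʳ z

    blocks-↑ˡ : ∀ i → blocks (i ↑ˡ h) ≡ top i
    blocks-↑ˡ i rewrite FP.splitAt-↑ˡ (h ℕ.+ r) i h = refl
    blocks-last : ∀ z → blocks (last z) ≡ eₘ z
    blocks-last z rewrite FP.splitAt-↑ʳ (h ℕ.+ r) h z = refl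
    top-first : ∀ z → top (z ↑ˡ r) ≡ e₀ z
    top-first z rewrite FP.splitAt-↑ˡ h z r = refl
    top-middle : ∀ k → top (h ↑ʳ k) ≡ mid k
    top-middle k rewrite FP.splitAt-↑ʳ h r k = refl
    blocks-first : ∀ z → blocks (first z) ≡ e₀ z
    blocks-first z = trans (blocks-↑ˡ (z ↑ˡ r)) (top-first z)
    blocks-middle : ∀ k → blocks (middle k) ≡ mid k
    blocks-middle k = trans (blocks-↑ˡ (h ↑ʳ k)) (top-middle k)

    -- Column operations: subtract column `first y` from column `last y`.
    colCoeff : Fin n → ℤ
    colCoeff c = [ (λ _ → + 0) , (λ _ → - + 1) ]′ (splitAt (h ℕ.+ r) c)
    colSource : Fin n → Fin n
    colSource c = [ (λ _ → c) , first ]′ (splitAt (h ℕ.+ r) c)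

    colCoeff-↑ˡ : ∀ i → colCoeff (i ↑ˡ h) ≡ + 0
    colCoeff-↑ˡ i rewrite FP.splitAt-↑ˡ (h ℕ.+ r) i h = refl
    colCoeff-last : ∀ y → colCoeff (last y) ≡ - + 1
    colCoeff-last y rewrite FP.splitAt-↑ʳ (h ℕ.+ r) h y = refl
    colSource-last : ∀ y → colSource (last y) ≡ first y
    colSource-last y rewrite FP.splitAt-↑ʳ (h ℕ.+ r) h y = refl

    -- Row operations: add row `last z` to row `first z`.
    rowCoeff : Fin n → ℤ
    rowCoeff i = [ (λ i′ → [ (λ _ → + 1) , (λ _ → + 0) ]′ (splitAt h i′)) , (λ _ → + 0) ]′ (splitAt (h ℕ.+ r) i)
    rowSource : Fin n → Fin n
    rowSource i = [ (λ i′ → [ last , (λ _ → i) ]′ (splitAt h i′)) , (λ _ → i) ]′ (splitAt (h ℕ.+ r) i)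

    rowCoeff-first : ∀ z → rowCoeff (first z) ≡ + 1
    rowCoeff-first z rewrite FP.splitAt-↑ˡ (h ℕ.+ r) (z ↑ˡ r) h | FP.splitAt-↑ˡ h z r = refl
    rowCoeff-middle : ∀ k → rowCoeff (middle k) ≡ + 0
    rowCoeff-middle k rewrite FP.splitAt-↑ˡ (h ℕ.+ r) (h ↑ʳ k) h | FP.splitAt-↑ʳ h r k = refl
    rowCoeff-last : ∀ y → rowCoeff (last y) ≡ + 0
    rowCoeff-last y rewrite FP.splitAt-↑ʳ (h ℕ.+ r) h y = refl
    rowSource-first : ∀ z → rowSource (first z) ≡ last z
    rowSource-first z rewrite FP.splitAt-↑ˡ (h ℕ.+ r) (z ↑ˡ r) h | FP.splitAt-↑ˡ h z r = refl

    first≢last : ∀ z → first z ≢ last z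
    first≢last z = ↑ˡ≢↑ʳ (h ℕ.+ r) h (z ↑ˡ r) z

  -- After the column and row operations above the matrix is block triangular:
  -- the hypotheses make the upper right block vanish, and F′ describes the rows
  -- e₀ z after row eₘ z has been added to them.
  det-peel : (F F′ : X → X → ℤ) →
    (∀ k y → F (mid k) (eₘ y) ≡ F (mid k) (e₀ y)) →
    (∀ z y → (F (e₀ z) (eₘ y) - F (e₀ z) (e₀ y)) + (F (eₘ z) (eₘ y) - F (eₘ z) (e₀ y)) ≡ + 0) →
    (∀ z j → F′ (e₀ z) (top j) ≡ F (e₀ z) (top j) + F (eₘ z) (top j)) →
    (∀ k j → F′ (mid k) (top j) ≡ F (mid k) (top j)) →
    det n (λ i j → F (blocks i) (blocks j))
      ≡ det (h ℕ.+ r) (λ i j → F′ (top i) (top j)) * det h (λ z y → F (eₘ z) (eₘ y) - F (eₘ z) (e₀ y))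
  det-peel F F′ mid-same first+last first′ mid′ =
    trans (sym (det-add-column-multiples n M colSource colCoeff column-ops-ok))
      (trans (sym (det-add-row-multiples n M₁ rowSource rowCoeff row-ops-ok))
        (trans (det-block-triangular (h ℕ.+ r) h M₂ upper-right-zero)
               (cong₂ _*_ (det-cong (h ℕ.+ r) upper-left) (det-cong h lower-right))))
    where
    M : Mat n
    M i j = F (blocks i) (blocks j)
    M₁ : Mat n
    M₁ i j = M i j + colCoeff j * M i (colSource j)
    M₂ : Mat n
    M₂ i j = M₁ i j + rowCoeff i * M₁ (rowSource i) j

    column-ops-ok : ∀ c → colCoeff c ≡ + 0 ⊎ (colSource c ≢ c × colCoeff (colSource c) ≡ + 0)
    column-ops-ok c with split (h ℕ.+ r) h c
    ... | left i = inj₁ (colCoeff-↑ˡ i)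
    ... | right y = inj₂ ((λ e → first≢last y (trans (sym (colSource-last y)) e)) ,
                          trans (cong colCoeff (colSource-last y)) (colCoeff-↑ˡ (y ↑ˡ r)))

    row-ops-ok : ∀ i → rowCoeff i ≡ + 0 ⊎ (rowSource i ≢ i × rowCoeff (rowSource i) ≡ + 0)
    row-ops-ok i with split (h ℕ.+ r) h i
    ... | right y = inj₁ (rowCoeff-last y)
    ... | left i′ with split h r i′
    ...   | right k = inj₁ (rowCoeff-middle k)
    ...   | left z = inj₂ ((λ e → first≢last z (sym (trans (sym (rowSource-first z)) e))) ,
                           trans (cong rowCoeff (rowSource-first z)) (rowCoeff-last z))

    M₁-↑ˡ : ∀ x j → M₁ x (j ↑ˡ h) ≡ M x (j ↑ˡ h)
    M₁-↑ˡ x j = trans (cong (λ c → M x (j ↑ˡ h) + c * M x (colSource (j ↑ˡ h))) (colCoeff-↑ˡ j))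
                      (x+0*y≡x _ (M x (colSource (j ↑ˡ h))))
    M₁-last : ∀ x y → M₁ x (last y) ≡ M x (last y) - M x (first y)
    M₁-last x y = trans (cong₂ (λ c d → M x (last y) + c * M x d) (colCoeff-last y) (colSource-last y))
                        (cong (_+_ (M x (last y))) (ℤP.-1*i≡-i (M x (first y))))
    M₂-first : ∀ z j → M₂ (first z) j ≡ M₁ (first z) j + M₁ (last z) j
    M₂-first z j = trans (cong₂ (λ c s → M₁ (first z) j + c * M₁ s j) (rowCoeff-first z) (rowSource-first z))
                         (cong (_+_ (M₁ (first z) j)) (ℤP.*-identityˡ _))
    M₂-unchanged : ∀ i j → rowCoeff i ≡ + 0 → M₂ i j ≡ M₁ i j
    M₂-unchanged i j c≡0 = trans (cong (λ c → M₁ i j + c * M₁ (rowSource i) j) c≡0)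
                                 (x+0*y≡x _ (M₁ (rowSource i) j))


    upper-right-zero : ∀ i y → M₂ (i ↑ˡ h) (last y) ≡ + 0
    upper-right-zero i y with split h r i
    ... | left z = begin
      M₂ (first z) (last y)                                                 ≡⟨ M₂-first z (last y) ⟩
      M₁ (first z) (last y) + M₁ (last z) (last y)                          ≡⟨ cong₂ _+_ (M₁-last (first z) y) (M₁-last (last z) y) ⟩
      (M (first z) (last y) - M (first z) (first y)) + (M (last z) (last y) - M (last z) (first y))
        ≡⟨ cong₂ _+_ (cong₂ _-_ (cong₂ F (blocks-first z) (blocks-last y)) (cong₂ F (blocks-first z) (blocks-first y)))
                     (cong₂ _-_ (cong₂ F (blocks-last z) (blocks-last y)) (cong₂ F (blocks-last z) (blocks-first y))) ⟩
      (F (e₀ z) (eₘ y) - F (e₀ z) (e₀ y)) + (F (eₘ z) (eₘ y) - F (eₘ z) (e₀ y)) ≡⟨ first+last z y ⟩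
      + 0                                                                   ∎
      where open ≡-Reasoning
    ... | right k = begin
      M₂ (middle k) (last y)                                ≡⟨ M₂-unchanged (middle k) (last y) (rowCoeff-middle k) ⟩
      M₁ (middle k) (last y)                                ≡⟨ M₁-last (middle k) y ⟩
      M (middle k) (last y) - M (middle k) (first y)        ≡⟨ cong₂ _-_ (cong₂ F (blocks-middle k) (blocks-last y))
                                                                         (cong₂ F (blocks-middle k) (blocks-first y)) ⟩
      F (mid k) (eₘ y) - F (mid k) (e₀ y)                   ≡⟨ cong (_- F (mid k) (e₀ y)) (mid-same k y) ⟩
      F (mid k) (e₀ y) - F (mid k) (e₀ y)                   ≡⟨ ℤP.+-inverseʳ (F (mid k) (e₀ y)) ⟩
      + 0                                                   ∎
      where open ≡-Reasoning

    upper-left : ∀ i j → M₂ (i ↑ˡ h) (j ↑ˡ h) ≡ F′ (top i) (top j)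
    upper-left i j with split h r i
    ... | left z = begin
      M₂ (first z) (j ↑ˡ h)                               ≡⟨ M₂-first z (j ↑ˡ h) ⟩
      M₁ (first z) (j ↑ˡ h) + M₁ (last z) (j ↑ˡ h)        ≡⟨ cong₂ _+_ (M₁-↑ˡ (first z) j) (M₁-↑ˡ (last z) j) ⟩
      M (first z) (j ↑ˡ h) + M (last z) (j ↑ˡ h)          ≡⟨ cong₂ _+_ (cong₂ F (blocks-first z) (blocks-↑ˡ j))
                                                                       (cong₂ F (blocks-last z) (blocks-↑ˡ j)) ⟩
      F (e₀ z) (top j) + F (eₘ z) (top j)                 ≡⟨ sym (first′ z j) ⟩
      F′ (e₀ z) (top j)                                   ≡⟨ cong (λ a → F′ a (top j)) (sym (top-first z)) ⟩
      F′ (top (z ↑ˡ r)) (top j)                           ∎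
      where open ≡-Reasoning
    ... | right k = begin
      M₂ (middle k) (j ↑ˡ h)         ≡⟨ M₂-unchanged (middle k) (j ↑ˡ h) (rowCoeff-middle k) ⟩
      M₁ (middle k) (j ↑ˡ h)         ≡⟨ M₁-↑ˡ (middle k) j ⟩
      M (middle k) (j ↑ˡ h)          ≡⟨ cong₂ F (blocks-middle k) (blocks-↑ˡ j) ⟩
      F (mid k) (top j)              ≡⟨ sym (mid′ k j) ⟩
      F′ (mid k) (top j)             ≡⟨ cong (λ a → F′ a (top j)) (sym (top-middle k)) ⟩
      F′ (top (h ↑ʳ k)) (top j)      ∎
      where open ≡-Reasoning

    lower-right : ∀ z y → M₂ (last z) (last y) ≡ F (eₘ z) (eₘ y) - F (eₘ z) (e₀ y)
    lower-right z y =
      trans (M₂-unchanged (last z) (last y) (rowCoeff-last z))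
        (trans (M₁-last (last z) y)
               (cong₂ _-_ (cong₂ F (blocks-last z) (blocks-last y)) (cong₂ F (blocks-last z) (blocks-first y))))

module _ {X Y : Set} (F F′ : X → X → ℤ) (e₀ eₘ : Y → X) (Hs : List Y) (R : List X) where

  detOn-peel :
    (∀ {c} → c ∈ R → ∀ y → F c (eₘ y) ≡ F c (e₀ y)) →
    (∀ z y → (F (e₀ z) (eₘ y) - F (e₀ z) (e₀ y)) + (F (eₘ z) (eₘ y) - F (eₘ z) (e₀ y)) ≡ + 0) →
    (∀ z {c} → c ∈ map e₀ Hs ++ R → F′ (e₀ z) c ≡ F (e₀ z) c + F (eₘ z) c) →
    (∀ {c} → c ∈ R → ∀ d → F′ c d ≡ F c d) →
    detOn F ((map e₀ Hs ++ R) ++ map eₘ Hs)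
      ≡ detOn F′ (map e₀ Hs ++ R) * detOn (λ z y → F (eₘ z) (eₘ y) - F (eₘ z) (e₀ y)) Hs
  detOn-peel mid-same first+last first′ mid′ =
    trans (cong (detOn F) whole-list)
      (trans (detOn-tabulate F (blocks h r E₀ Eₘ Mid))
        (trans (det-peel h r E₀ Eₘ Mid F F′
                  (λ k y → mid-same (∈-lookup k) (lookup Hs y))
                  (λ z y → first+last (lookup Hs z) (lookup Hs y))
                  (λ z j → first′ (lookup Hs z) (top∈ j))
                  (λ k j → mid′ (∈-lookup k) (top h r E₀ Eₘ Mid j)))
               (cong₂ _*_ (sym (trans (cong (detOn F′) top-list) (detOn-tabulate F′ (top h r E₀ Eₘ Mid))))
                          (sym (detOn-as-det (λ z y → F (eₘ z) (eₘ y) - F (eₘ z) (e₀ y)) Hs)))))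
    where
    h = length Hs
    r = length R
    E₀ Eₘ : Fin h → X
    E₀ z = e₀ (lookup Hs z)
    Eₘ z = eₘ (lookup Hs z)
    Mid : Fin r → X
    Mid = lookup R
    top-list : map e₀ Hs ++ R ≡ tabulate (top h r E₀ Eₘ Mid)
    top-list = trans (cong₂ _++_ (map-as-tabulate e₀ Hs) (sym (LP.tabulate-lookup R))) (tabulate-++ E₀ Mid)
    whole-list : (map e₀ Hs ++ R) ++ map eₘ Hs ≡ tabulate (blocks h r E₀ Eₘ Mid)
    whole-list = trans (cong₂ _++_ top-list (map-as-tabulate eₘ Hs)) (tabulate-++ (top h r E₀ Eₘ Mid) Eₘ)
    top∈ : ∀ j → top h r E₀ Eₘ Mid j ∈ map e₀ Hs ++ R
    top∈ j = subst (top h r E₀ Eₘ Mid j ∈_) (sym top-list) (∈-tabulate⁺ j)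

-- Block matrices with repeated copies

δ-refl : ∀ {k} (i : Fin k) → δ i i ≡ + 1
δ-refl i with i F.≟ i
... | yes _ = refl
... | no i≢i = ⊥-elim (i≢i refl)

δ-≢ : ∀ {k} {i j : Fin k} → i ≢ j → δ i j ≡ + 0
δ-≢ {i = i} {j} i≢j with i F.≟ j
... | yes e = ⊥-elim (i≢j e)
... | no _ = refl

δ-sym : ∀ {k} (i j : Fin k) → δ i j ≡ δ j i
δ-sym i j with i F.≟ j | j F.≟ i
... | yes _ | yes _ = refl
... | no _  | no _  = refl
... | yes e | no ne = ⊥-elim (ne (sym e))
... | no ne | yes e = ⊥-elim (ne (sym e))

Index : Set → Set → ℕ → Set
Index P Y k = P ⊎ (Fin (suc k) × Y)

copies : ∀ {P Y : Set} (Hs : List Y) k → List (Index P Y k)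
copies Hs k = concatMap (λ i → map (λ y → inj₂ (i , y)) Hs) (allFin (suc k))

-- The peeling argument is carried out for the transpose of the matrix in
-- det-copies below: suc k copies of [[A, B], [C, D]] sharing the P-block,
-- in which the coupling row C of copy zero carries a weight w.
private module Weighted {P Y : Set} (A : P → P → ℤ) (B : P → Y → ℤ) (C : Y → P → ℤ) (D : Y → Y → ℤ) (Ps : List P) (Hs : List Y) where

  module _ (k : ℕ) where

    Ix : Set
    Ix = Index P Y k

    weight : ℤ → Fin (suc k) → ℤ
    weight w zero    = w
    weight w (suc _) = + 1

    weight-≢0 : ∀ w {j} → j ≢ zero → weight w j ≡ + 1
    weight-≢0 w {zero}  j≢0 = ⊥-elim (j≢0 refl)
    weight-≢0 w {suc _} _   = refl

    weightedCopies : ℤ → Ix → Ix → ℤ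
    weightedCopies w (inj₁ p)       (inj₁ p′)      = A p p′
    weightedCopies w (inj₁ p)       (inj₂ (_ , y)) = B p y
    weightedCopies w (inj₂ (i , z)) (inj₁ p)       = weight w i * C z p
    weightedCopies w (inj₂ (i , z)) (inj₂ (j , y)) = δ i j * D z y

    fixed : List Ix
    fixed = map inj₁ Ps

    copy : Fin (suc k) → List Ix
    copy i = map (λ y → inj₂ (i , y)) Hs

    OffCopy : Fin (suc k) → Ix → Set
    OffCopy j (inj₁ _)       = ⊤
    OffCopy j (inj₂ (i , _)) = i ≢ j

    private
      module Step (w : ℤ) (j : Fin (suc k)) (j≢0 : j ≢ zero) where
        F F′ : Ix → Ix → ℤ
        F = weightedCopies w
        F′ = weightedCopies (w + + 1)
        e₀ eⱼ : Y → Ix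
        e₀ y = inj₂ (zero , y)
        eⱼ y = inj₂ (j , y)

        rows-off-zero-unchanged : ∀ {c} → OffCopy zero c → ∀ d → F′ c d ≡ F c d
        rows-off-zero-unchanged {inj₁ _} _ (inj₁ _) = refl
        rows-off-zero-unchanged {inj₁ _} _ (inj₂ _) = refl
        rows-off-zero-unchanged {inj₂ (zero , _)} i≢0 _ = ⊥-elim (i≢0 refl)
        rows-off-zero-unchanged {inj₂ (suc _ , _)} _ (inj₁ _) = refl
        rows-off-zero-unchanged {inj₂ (suc _ , _)} _ (inj₂ _) = refl

        columns-agree : ∀ {c} → OffCopy zero c → OffCopy j c → ∀ y → F c (eⱼ y) ≡ F c (e₀ y)
        columns-agree {inj₁ _} _ _ y = refl
        columns-agree {inj₂ (i , z)} i≢0 i≢j y =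
          trans (cong (_* D z y) (δ-≢ i≢j)) (cong (_* D z y) (sym (δ-≢ i≢0)))

        copy-zero-row-absorbs : ∀ z {c} → OffCopy j c → F′ (e₀ z) c ≡ F (e₀ z) c + F (eⱼ z) c
        copy-zero-row-absorbs z {inj₁ p} _ =
          trans (ℤP.*-distribʳ-+ (C z p) w (+ 1)) (cong (λ t → w * C z p + t * C z p) (sym (weight-≢0 w j≢0)))
        copy-zero-row-absorbs z {inj₂ (i , y)} i≢j =
          sym (trans (cong (λ t → δ zero i * D z y + t * D z y) (δ-≢ (λ j≡i → i≢j (sym j≡i))))
                     (x+0*y≡x _ (D z y)))

        zero-and-j : ∀ z y → (F (e₀ z) (eⱼ y) - F (e₀ z) (e₀ y)) + (F (eⱼ z) (eⱼ y) - F (eⱼ z) (e₀ y)) ≡ + 0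
        zero-and-j z y rewrite δ-≢ (λ 0≡j → j≢0 (sym 0≡j)) | δ-refl {suc k} zero | δ-refl j | δ-≢ j≢0 = cancel (D z y)
          where
          cancel : ∀ d → (+ 0 * d - + 1 * d) + (+ 1 * d - + 0 * d) ≡ + 0
          cancel = solve-∀

        diagonal-block : ∀ z y → F (eⱼ z) (eⱼ y) - F (eⱼ z) (e₀ y) ≡ D z y
        diagonal-block z y rewrite δ-refl j | δ-≢ j≢0 = solve (D z y)
          where
          solve : ∀ d → + 1 * d - + 0 * d ≡ d
          solve = solve-∀

      off-copies : ∀ j (ks : List (Fin (suc k))) → All (_≢ j) ks → All (OffCopy j) (concatMap copy ks)
      off-copies j []       []           = []
      off-copies j (i ∷ ks) (i≢j ∷ rest) = All.++⁺ (All.map⁺ (All.universal (λ _ → i≢j) Hs)) (off-copies j ks rest)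

      off-fixed : ∀ j → All (OffCopy j) fixed
      off-fixed j = All.map⁺ (All.universal (λ _ → tt) Ps)

    -- Peeling off copy j adds its coupling row C to that of copy zero.
    det-peel-copies : ∀ w (ks : List (Fin (suc k))) → All (_≢ zero) ks → Unique ks →
      detOn (weightedCopies w) (fixed ++ copy zero ++ concatMap copy ks)
        ≡ detOn (weightedCopies (w + + length ks)) (fixed ++ copy zero) * detOn D Hs ^ length ks
    det-peel-copies w [] [] AllPairs.[] =
      trans (cong₂ (λ v xs → detOn (weightedCopies v) (fixed ++ xs)) (sym (ℤP.+-identityʳ w)) (LP.++-identityʳ (copy zero)))
            (sym (ℤP.*-identityʳ _))
    det-peel-copies w (j ∷ ks) (j≢0 ∷ ks≢0) (j∉ks ∷ unique) = begin
      detOn F (fixed ++ copy zero ++ copy j ++ rest)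
        ≡⟨ detOn-↭ F reorder ⟩
      detOn F ((copy zero ++ R) ++ copy j)
        ≡⟨ detOn-peel F F′ e₀ eⱼ Hs R
             (λ c∈R → columns-agree (All.lookup R-off-zero c∈R) (All.lookup R-off-j c∈R))
             zero-and-j
             (λ z c∈ → copy-zero-row-absorbs z (All.lookup (All.++⁺ copy-zero-off-j R-off-j) c∈))
             (λ c∈R → rows-off-zero-unchanged (All.lookup R-off-zero c∈R)) ⟩
      detOn F′ (copy zero ++ R) * detOn (λ z y → F (eⱼ z) (eⱼ y) - F (eⱼ z) (e₀ y)) Hs
        ≡⟨ cong₂ _*_ (detOn-↭ F′ (↭.shifts (copy zero) fixed)) (detOn-cong Hs diagonal-block) ⟩
      detOn F′ (fixed ++ copy zero ++ rest) * detOn D Hs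
        ≡⟨ cong (_* detOn D Hs) (det-peel-copies (w + + 1) ks ks≢0 unique) ⟩
      detOn (weightedCopies ((w + + 1) + + length ks)) (fixed ++ copy zero) * detOn D Hs ^ length ks * detOn D Hs
        ≡⟨ cong (λ v → detOn (weightedCopies v) (fixed ++ copy zero) * detOn D Hs ^ length ks * detOn D Hs)
                (ℤP.+-assoc w (+ 1) (+ length ks)) ⟩
      detOn (weightedCopies (w + + suc (length ks))) (fixed ++ copy zero) * detOn D Hs ^ length ks * detOn D Hs
        ≡⟨ trans (ℤP.*-assoc (detOn (weightedCopies (w + + suc (length ks))) (fixed ++ copy zero)) _ _)
                 (cong (detOn (weightedCopies (w + + suc (length ks))) (fixed ++ copy zero) *_)
                       (ℤP.*-comm (detOn D Hs ^ length ks) (detOn D Hs))) ⟩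
      detOn (weightedCopies (w + + suc (length ks))) (fixed ++ copy zero) * detOn D Hs ^ suc (length ks) ∎
      where
      open ≡-Reasoning
      open Step w j j≢0
      rest = concatMap copy ks
      R = fixed ++ rest
      reorder : fixed ++ copy zero ++ copy j ++ rest ↭ (copy zero ++ R) ++ copy j
      reorder = ↭-trans (↭.shifts fixed (copy zero))
                  (↭-trans (↭.++⁺ˡ (copy zero) (↭.shifts fixed (copy j)))
                    (↭-trans (↭.shifts (copy zero) (copy j)) (↭.++-comm (copy j) (copy zero ++ R))))
      R-off-zero : All (OffCopy zero) R
      R-off-zero = All.++⁺ (off-fixed zero) (off-copies zero ks ks≢0)
      R-off-j : All (OffCopy j) R
      R-off-j = All.++⁺ (off-fixed j) (off-copies j ks (All.map (λ j≢i i≡j → j≢i (sym i≡j)) j∉ks))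
      copy-zero-off-j : All (OffCopy j) (copy zero)
      copy-zero-off-j = All.map⁺ (All.universal (λ _ 0≡j → j≢0 (sym 0≡j)) Hs)

  weightedQuotient : ℤ → P ⊎ Y → P ⊎ Y → ℤ
  weightedQuotient w (inj₁ p) (inj₁ p′) = A p p′
  weightedQuotient w (inj₁ p) (inj₂ y)  = B p y
  weightedQuotient w (inj₂ z) (inj₁ p)  = w * C z p
  weightedQuotient w (inj₂ z) (inj₂ y)  = D z y

  det-weighted-copies : ∀ k → detOn (weightedCopies k (+ 1)) (fixed k ++ concatMap (copy k) (allFin (suc k)))
                       ≡ detOn (weightedQuotient (+ suc k)) (map inj₁ Ps ++ map inj₂ Hs) * detOn D Hs ^ k
  det-weighted-copies k =
    trans (det-peel-copies k (+ 1) (tabulate suc) (All.tabulate⁺ (λ _ ())) (Unique.tabulate⁺ FP.suc-injective))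
          (subst (λ n → detOn (weightedCopies k (+ 1 + + n)) (fixed k ++ copy k zero) * detOn D Hs ^ n
                          ≡ detOn (weightedQuotient (+ suc k)) (map inj₁ Ps ++ map inj₂ Hs) * detOn D Hs ^ k)
                 (sym (LP.length-tabulate suc))
                 (cong (_* detOn D Hs ^ k) (trans (cong (detOn (weightedCopies k (+ suc k))) copy-zero-list)
                                                  (trans (detOn-map (weightedCopies k (+ suc k)) embed (map inj₁ Ps ++ map inj₂ Hs))
                                                                (detOn-cong (map inj₁ Ps ++ map inj₂ Hs) embedded-entries)))))
    where
    embed : P ⊎ Y → Index P Y k
    embed (inj₁ p) = inj₁ p
    embed (inj₂ y) = inj₂ (zero , y)
    copy-zero-list : fixed k ++ copy k zero ≡ map embed (map inj₁ Ps ++ map inj₂ Hs)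
    copy-zero-list = sym (trans (LP.map-++ embed (map inj₁ Ps) (map inj₂ Hs))
                                (cong₂ _++_ (sym (LP.map-∘ Ps)) (sym (LP.map-∘ Hs))))
    embedded-entries : ∀ a b → weightedCopies k (+ suc k) (embed a) (embed b) ≡ weightedQuotient (+ suc k) a b
    embedded-entries (inj₁ _) (inj₁ _) = refl
    embedded-entries (inj₁ _) (inj₂ _) = refl
    embedded-entries (inj₂ _) (inj₁ _) = refl
    embedded-entries (inj₂ z) (inj₂ y) = ℤP.*-identityˡ (D z y)

module _ {P Y : Set} (A : P → P → ℤ) (B : P → Y → ℤ) (C : Y → P → ℤ) (D : Y → Y → ℤ) where

  -- [[A, 1ᵀ ⊗ B], [1 ⊗ C, I ⊗ D]], with suc k copies of the Y-block.
  copiesMatrix : ∀ k → Index P Y k → Index P Y k → ℤ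
  copiesMatrix k (inj₁ p)       (inj₁ p′)      = A p p′
  copiesMatrix k (inj₁ p)       (inj₂ (_ , y)) = B p y
  copiesMatrix k (inj₂ (_ , z)) (inj₁ p)       = C z p
  copiesMatrix k (inj₂ (i , z)) (inj₂ (j , y)) = δ i j * D z y

  quotientMatrix : ℤ → P ⊎ Y → P ⊎ Y → ℤ
  quotientMatrix w (inj₁ p) (inj₁ p′) = A p p′
  quotientMatrix w (inj₁ p) (inj₂ y)  = w * B p y
  quotientMatrix w (inj₂ z) (inj₁ p)  = C z p
  quotientMatrix w (inj₂ z) (inj₂ y)  = D z y

  det-copies : ∀ (Ps : List P) (Hs : List Y) k →
    detOn (copiesMatrix k) (map inj₁ Ps ++ copies Hs k)
      ≡ detOn (quotientMatrix (+ suc k)) (map inj₁ Ps ++ map inj₂ Hs) * detOn D Hs ^ k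
  det-copies Ps Hs k =
    trans (sym (detOn-transpose (copiesMatrix k) all-copies))
      (trans (detOn-cong all-copies transposed)
        (trans (Weighted.det-weighted-copies Aᵀ Cᵀ Bᵀ Dᵀ Ps Hs k)
               (cong₂ (λ a b → a * b ^ k)
                      (trans (detOn-cong (map inj₁ Ps ++ map inj₂ Hs) quotient-transposed)
                             (detOn-transpose (quotientMatrix (+ suc k)) (map inj₁ Ps ++ map inj₂ Hs)))
                      (detOn-transpose D Hs))))
    where
    all-copies = map inj₁ Ps ++ copies Hs k
    Aᵀ : P → P → ℤ
    Aᵀ p p′ = A p′ p
    Bᵀ : Y → P → ℤ
    Bᵀ z p = B p z
    Cᵀ : P → Y → ℤ
    Cᵀ p z = C z p
    Dᵀ : Y → Y → ℤ
    Dᵀ z y = D y z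
    transposed : ∀ a b → copiesMatrix k b a ≡ Weighted.weightedCopies Aᵀ Cᵀ Bᵀ Dᵀ Ps Hs k (+ 1) a b
    transposed (inj₁ _)             (inj₁ _)       = refl
    transposed (inj₁ _)             (inj₂ _)       = refl
    transposed (inj₂ (zero , z))    (inj₁ p)       = sym (ℤP.*-identityˡ (B p z))
    transposed (inj₂ (suc _ , z))   (inj₁ p)       = sym (ℤP.*-identityˡ (B p z))
    transposed (inj₂ (i , z))       (inj₂ (j , y)) = cong (_* D y z) (δ-sym j i)
    quotient-transposed : ∀ a b → Weighted.weightedQuotient Aᵀ Cᵀ Bᵀ Dᵀ Ps Hs (+ suc k) a b ≡ quotientMatrix (+ suc k) b a
    quotient-transposed (inj₁ _) (inj₁ _) = refl
    quotient-transposed (inj₁ _) (inj₂ _) = refl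
    quotient-transposed (inj₂ _) (inj₁ _) = refl
    quotient-transposed (inj₂ _) (inj₂ _) = refl

map-copies : ∀ {P Y X : Set} {k} (ι : Index P Y k → X) (Ps : List P) (Hs : List Y) →
  map ι (map inj₁ Ps ++ copies Hs k)
    ≡ map (λ p → ι (inj₁ p)) Ps ++ concat (tabulate (λ i → map (λ y → ι (inj₂ (i , y))) Hs))
map-copies {k = k} ι Ps Hs =
  trans (LP.map-++ ι (map inj₁ Ps) _)
    (cong₂ _++_ (sym (LP.map-∘ Ps))
                (trans (LP.map-concatMap ι copy (allFin (suc k)))
                       (cong concat (trans (LP.map-tabulate (λ i → i) (λ i → map ι (copy i)))
                                           (LP.tabulate-cong (λ i → sym (LP.map-∘ {g = ι} {f = λ y → inj₂ (i , y)} Hs)))))))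
  where
  copy : Fin (suc k) → List _
  copy i = map (λ y → inj₂ (i , y)) Hs

-- The index order of T₂

tabulate-↑ : ∀ {A : Set} m n (f : Fin (m ℕ.+ n) → A) →
             tabulate f ≡ tabulate (λ i → f (i ↑ˡ n)) ++ tabulate (λ j → f (m ↑ʳ j))
tabulate-↑ zero    n f = refl
tabulate-↑ (suc m) n f = cong (f zero ∷_) (tabulate-↑ m n (λ i → f (suc i)))

tabulate-combine : ∀ {A : Set} m n (f : Fin (m ℕ.* n) → A) →
                   tabulate f ≡ concat (tabulate (λ (i : Fin m) → tabulate (λ (j : Fin n) → f (combine i j))))
tabulate-combine zero    n f = refl
tabulate-combine (suc m) n f =
  trans (tabulate-↑ n (m ℕ.* n) f) (cong (tabulate (λ j → f (j ↑ˡ m ℕ.* n)) ++_) (tabulate-combine m n (λ k → f (n ↑ʳ k))))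

concat-singletons : ∀ {A : Set} {n} (f : Fin n → A) → concat (tabulate (λ i → [ f i ])) ≡ tabulate f
concat-singletons {n = zero}  f = refl
concat-singletons {n = suc n} f = cong (f zero ∷_) (concat-singletons (λ i → f (suc i)))

interleave : ∀ {A : Set} {n} (a : Fin n → A) (rows : Fin n → List A) →
             tabulate a ++ concat (tabulate rows) ↭ concat (tabulate (λ i → a i ∷ rows i))
interleave {n = zero}  a rows = ↭-refl
interleave {n = suc n} a rows =
  ↭-prep (a zero) (↭-trans (↭.shifts (tabulate (λ i → a (suc i))) (rows zero))
                            (↭.++⁺ˡ (rows zero) (interleave (λ i → a (suc i)) (λ i → rows (suc i)))))

pattern U        = inj₁ tt
pattern A i      = inj₂ (inj₁ i)
pattern AB i j   = inj₂ (inj₂ (inj₁ (i , j)))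
pattern B j      = inj₂ (inj₂ (inj₂ j))

module _ (α β : ℕ) where

  private
    s₁ = 1 ℕ.+ α
    s₂ = 1 ℕ.+ α ℕ.+ α ℕ.* β

  -- The Kronecker delta of Idx, in the shape in which T₂blk uses it.
  δIdx : Idx α β → Idx α β → ℤ
  δIdx U        U          = + 1
  δIdx (A i)    (A i′)     = δ i i′
  δIdx (AB i j) (AB i′ j′) = δ i i′ * δ j j′
  δIdx (B j)    (B j′)     = δ j j′
  δIdx _        _          = + 0

  δIdx-refl : ∀ c → δIdx c c ≡ + 1
  δIdx-refl U        = refl
  δIdx-refl (A i)    = δ-refl i
  δIdx-refl (AB i j) = cong₂ _*_ (δ-refl i) (δ-refl j)
  δIdx-refl (B j)    = δ-refl j

  δIdx-≢ : ∀ c d → c ≢ d → δIdx c d ≡ + 0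
  δIdx-≢ U        U          c≢d = ⊥-elim (c≢d refl)
  δIdx-≢ (A i)    (A i′)     c≢d = δ-≢ (λ e → c≢d (cong A e))
  δIdx-≢ (AB i j) (AB i′ j′) c≢d = by-cases (i F.≟ i′)
    where
    by-cases : Dec (i ≡ i′) → δ i i′ * δ j j′ ≡ + 0
    by-cases (no i≢i′)  = trans (cong (_* δ j j′) (δ-≢ i≢i′)) (ℤP.*-zeroˡ (δ j j′))
    by-cases (yes refl) = trans (cong (δ i i *_) (δ-≢ (λ e → c≢d (cong (AB i) e)))) (ℤP.*-zeroʳ (δ i i))
  δIdx-≢ (B j)    (B j′)     c≢d = δ-≢ (λ e → c≢d (cong B e))
  δIdx-≢ U        (A _)      _ = refl
  δIdx-≢ U        (AB _ _)   _ = refl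
  δIdx-≢ U        (B _)      _ = refl
  δIdx-≢ (A _)    U          _ = refl
  δIdx-≢ (A _)    (AB _ _)   _ = refl
  δIdx-≢ (A _)    (B _)      _ = refl
  δIdx-≢ (AB _ _) U          _ = refl
  δIdx-≢ (AB _ _) (A _)      _ = refl
  δIdx-≢ (AB _ _) (B _)      _ = refl
  δIdx-≢ (B _)    U          _ = refl
  δIdx-≢ (B _)    (A _)      _ = refl
  δIdx-≢ (B _)    (AB _ _)   _ = refl

  fromIdx : Idx α β → Fin (N α β)
  fromIdx U        = ((zero ↑ˡ α) ↑ˡ α ℕ.* β) ↑ˡ β
  fromIdx (A i)    = ((1 ↑ʳ i) ↑ˡ α ℕ.* β) ↑ˡ β
  fromIdx (AB i j) = (s₁ ↑ʳ combine i j) ↑ˡ β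
  fromIdx (B j)    = s₂ ↑ʳ j

  fromIdx-toIdx : ∀ k → fromIdx (toIdx α β k) ≡ k
  fromIdx-toIdx k with splitAt s₂ k in eq₁
  ... | inj₂ j = FP.splitAt⁻¹-↑ʳ eq₁
  ... | inj₁ k₁ with splitAt s₁ k₁ in eq₂
  ...   | inj₂ ij = trans (cong (λ t → (s₁ ↑ʳ t) ↑ˡ β) (FP.combine-remQuot {α} β ij))
                          (trans (cong (_↑ˡ β) (FP.splitAt⁻¹-↑ʳ eq₂)) (FP.splitAt⁻¹-↑ˡ eq₁))
  ...   | inj₁ k₂ with splitAt 1 k₂ in eq₃
  ...     | inj₁ zero = trans (cong (λ t → (t ↑ˡ α ℕ.* β) ↑ˡ β) (FP.splitAt⁻¹-↑ˡ eq₃))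
                              (trans (cong (_↑ˡ β) (FP.splitAt⁻¹-↑ˡ eq₂)) (FP.splitAt⁻¹-↑ˡ eq₁))
  ...     | inj₂ i    = trans (cong (λ t → (t ↑ˡ α ℕ.* β) ↑ˡ β) (FP.splitAt⁻¹-↑ʳ eq₃))
                              (trans (cong (_↑ˡ β) (FP.splitAt⁻¹-↑ˡ eq₂)) (FP.splitAt⁻¹-↑ˡ eq₁))

  toIdx-injective : ∀ {k l} → toIdx α β k ≡ toIdx α β l → k ≡ l
  toIdx-injective {k} {l} e = trans (sym (fromIdx-toIdx k)) (trans (cong fromIdx e) (fromIdx-toIdx l))

  δ-toIdx : ∀ (k l : Fin (N α β)) → δ k l ≡ δIdx (toIdx α β k) (toIdx α β l)
  δ-toIdx k l with k F.≟ l
  ... | yes refl = sym (δIdx-refl (toIdx α β k))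
  ... | no k≢l   = sym (δIdx-≢ (toIdx α β k) (toIdx α β l) (λ e → k≢l (toIdx-injective e)))

  tabulate-toIdx : tabulate (toIdx α β)
                   ≡ (U ∷ tabulate A ++ concat (tabulate (λ i → tabulate (AB i)))) ++ tabulate B
  tabulate-toIdx =
    trans (tabulate-↑ s₂ β (toIdx α β))
      (cong₂ _++_ (trans (tabulate-↑ s₁ (α ℕ.* β) (λ k → toIdx α β (k ↑ˡ β)))
                         (cong₂ _++_ (cong₂ _∷_ toIdx-U (LP.tabulate-cong toIdx-A))
                                     (trans (tabulate-combine α β (λ k → toIdx α β ((s₁ ↑ʳ k) ↑ˡ β)))
                                            (cong concat (LP.tabulate-cong (λ i → LP.tabulate-cong (toIdx-AB i)))))))
                  (LP.tabulate-cong toIdx-B))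
    where
    toIdx-U : toIdx α β ((zero ↑ˡ α ↑ˡ α ℕ.* β) ↑ˡ β) ≡ U
    toIdx-U rewrite FP.splitAt-↑ˡ s₂ (zero ↑ˡ α ↑ˡ α ℕ.* β) β | FP.splitAt-↑ˡ s₁ (zero {α}) (α ℕ.* β) = refl
    toIdx-A : ∀ i → toIdx α β ((suc i ↑ˡ α ℕ.* β) ↑ˡ β) ≡ A i
    toIdx-A i rewrite FP.splitAt-↑ˡ s₂ (suc i ↑ˡ α ℕ.* β) β | FP.splitAt-↑ˡ s₁ (suc i) (α ℕ.* β) = refl
    toIdx-AB : ∀ i j → toIdx α β ((s₁ ↑ʳ combine i j) ↑ˡ β) ≡ AB i j
    toIdx-AB i j rewrite FP.splitAt-↑ˡ s₂ (s₁ ↑ʳ combine i j) β | FP.splitAt-↑ʳ s₁ (α ℕ.* β) (combine i j)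
                       | FP.remQuot-combine {α} {β} i j = refl
    toIdx-B : ∀ j → toIdx α β (s₂ ↑ʳ j) ≡ B j
    toIdx-B j rewrite FP.splitAt-↑ʳ s₂ β j = refl

private
  scale-diagonal : ∀ x d t → x * d - t * d ≡ d * (x * + 1 - t * + 1)
  scale-diagonal = solve-∀
  scale-diagonal′ : ∀ x d t → x * (+ 1 * d) - t * (+ 1 * d) ≡ d * (x * + 1 - t * + 1)
  scale-diagonal′ = solve-∀
  scale-diagonal² : ∀ x d e t → x * (d * e) - t * (d * e) ≡ d * (x * (+ 1 * e) - t * (+ 1 * e))
  scale-diagonal² = solve-∀
  scale-off-diagonal : ∀ x d t → x * + 0 - t * d ≡ d * (x * + 0 - t * + 1)
  scale-off-diagonal = solve-∀
  scale-weighted : ∀ x w d t → w * (x * + 0 - t * d) ≡ d * (w * (x * + 0 - t * + 1))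
  scale-weighted = solve-∀
  weighted : ∀ x w t → w * (x * + 0 - t) ≡ x * + 0 - w * t
  weighted = solve-∀
  weighted-product : ∀ x v w s t → w * (v * (x * + 0 - s * t)) ≡ x * + 0 - (v * s) * (w * t)
  weighted-product = solve-∀
  weighted-right : ∀ x w s t → w * (x * + 0 - s * t * + 1) ≡ x * + 0 - s * (w * t)
  weighted-right = solve-∀
  weighted-left : ∀ x w s t → w * (x * + 0 - s * t * + 1) ≡ x * + 0 - (w * s) * t
  weighted-left = solve-∀
  c₀-as-pq : ∀ x P Q → x * + 1 - ((P - + 1) * (Q - + 1) - + 1) ≡ x - P * Q + P + Q
  c₀-as-pq = solve-∀

module Reduction (p q n m α′ β′ : ℕ) (x : ℤ) where

  α β : ℕ
  α = suc α′
  β = suc β′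

  P Q c₀ : ℤ
  P = + p
  Q = + q
  c₀ = (P - + 1) * (Q - + 1) - + 1

  G : Idx α β → Idx α β → ℤ
  G c d = x * δIdx α β c d - T₂blk p q n m α β c d

  φ-T₂ : φ (N α β) (T₂ p q n m α β) x ≡ detOn G (tabulate (toIdx α β))
  φ-T₂ = sym (trans (detOn-tabulate G (toIdx α β))
                    (det-cong (N α β) (λ k l → cong (λ e → x * e - T₂ p q n m α β k l) (sym (δ-toIdx α β k l)))))

  -- First reduction: α copies of the blocks {A i} ∪ {AB i j : j}, sharing U and the B j.
  data Shared : Set where
    u : Shared
    b : Fin β → Shared

  data Copy : Set where
    a  : Copy
    ab : Fin β → Copy

  ι₁ : Index Shared Copy α′ → Idx α β
  ι₁ (inj₁ u)            = U
  ι₁ (inj₁ (b j))        = B j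
  ι₁ (inj₂ (i , a))      = A i
  ι₁ (inj₂ (i , ab j))   = AB i j

  shared : List Shared
  shared = u ∷ tabulate b

  copy : List Copy
  copy = a ∷ tabulate ab

  A₁ : Shared → Shared → ℤ
  A₁ s s′ = G (ι₁ (inj₁ s)) (ι₁ (inj₁ s′))
  B₁ : Shared → Copy → ℤ
  B₁ s y = G (ι₁ (inj₁ s)) (ι₁ (inj₂ (zero , y)))
  C₁ : Copy → Shared → ℤ
  C₁ z s = G (ι₁ (inj₂ (zero , z))) (ι₁ (inj₁ s))
  D₁ : Copy → Copy → ℤ
  D₁ z y = G (ι₁ (inj₂ (zero , z))) (ι₁ (inj₂ (zero , y)))

  G-copies : ∀ c d → G (ι₁ c) (ι₁ d) ≡ copiesMatrix A₁ B₁ C₁ D₁ α′ c d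
  G-copies (inj₁ _)            (inj₁ _)             = refl
  G-copies (inj₁ u)            (inj₂ (_ , a))       = refl
  G-copies (inj₁ u)            (inj₂ (_ , ab _))    = refl
  G-copies (inj₁ (b _))        (inj₂ (_ , a))       = refl
  G-copies (inj₁ (b _))        (inj₂ (_ , ab _))    = refl
  G-copies (inj₂ (_ , a))      (inj₁ u)             = refl
  G-copies (inj₂ (_ , a))      (inj₁ (b _))         = refl
  G-copies (inj₂ (_ , ab _))   (inj₁ u)             = refl
  G-copies (inj₂ (_ , ab _))   (inj₁ (b _))         = refl
  G-copies (inj₂ (i , a))      (inj₂ (i′ , a))      = scale-diagonal x (δ i i′) (P - + 2)
  G-copies (inj₂ (i , a))      (inj₂ (i′ , ab _))   = scale-off-diagonal x (δ i i′) ((P - + 1) * (Q - + 1))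
  G-copies (inj₂ (i , ab _))   (inj₂ (i′ , a))      = scale-off-diagonal x (δ i i′) (P - + 1)
  G-copies (inj₂ (i , ab j))   (inj₂ (i′ , ab j′))  = scale-diagonal² x (δ i i′) (δ j j′) c₀

  T₂-order : tabulate (toIdx α β) ↭ map ι₁ (map inj₁ shared ++ copies copy α′)
  T₂-order = begin
    tabulate (toIdx α β)                                                ≡⟨ tabulate-toIdx α β ⟩
    U ∷ (tabulate A ++ concat (tabulate (λ i → tabulate (AB i)))) ++ tabulate B
                                                                        ↭⟨ ↭-prep U (↭.++-comm _ (tabulate B)) ⟩
    U ∷ tabulate B ++ tabulate A ++ concat (tabulate (λ i → tabulate (AB i)))
                                                                        ↭⟨ ↭-prep U (↭.++⁺ˡ (tabulate B) (interleave A (λ i → tabulate (AB i)))) ⟩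
    U ∷ tabulate B ++ concat (tabulate (λ i → A i ∷ tabulate (AB i)))   ≡⟨ sym images ⟩
    map ι₁ (map inj₁ shared ++ copies copy α′)                         ∎
    where
    open PermutationReasoning
    images : map ι₁ (map inj₁ shared ++ copies copy α′) ≡ U ∷ tabulate B ++ concat (tabulate (λ i → A i ∷ tabulate (AB i)))
    images = trans (map-copies ι₁ shared copy)
                   (cong₂ _++_ (cong (U ∷_) (LP.map-tabulate b (λ s → ι₁ (inj₁ s))))
                               (cong concat (LP.tabulate-cong (λ i → cong (A i ∷_) (LP.map-tabulate ab (λ y → ι₁ (inj₂ (i , y))))))))

  Q₁ : Shared ⊎ Copy → Shared ⊎ Copy → ℤ
  Q₁ = quotientMatrix A₁ B₁ C₁ D₁ (+ α)

  step₁ : φ (N α β) (T₂ p q n m α β) x ≡ detOn Q₁ (map inj₁ shared ++ map inj₂ copy) * detOn D₁ copy ^ α′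
  step₁ = begin
    φ (N α β) (T₂ p q n m α β) x                                 ≡⟨ φ-T₂ ⟩
    detOn G (tabulate (toIdx α β))                               ≡⟨ detOn-↭ G T₂-order ⟩
    detOn G (map ι₁ (map inj₁ shared ++ copies copy α′))         ≡⟨ detOn-map G ι₁ (map inj₁ shared ++ copies copy α′) ⟩
    detOn (λ c d → G (ι₁ c) (ι₁ d)) (map inj₁ shared ++ copies copy α′)
                                                                 ≡⟨ detOn-cong (map inj₁ shared ++ copies copy α′) G-copies ⟩
    detOn (copiesMatrix A₁ B₁ C₁ D₁ α′) (map inj₁ shared ++ copies copy α′)
                                                                 ≡⟨ det-copies A₁ B₁ C₁ D₁ shared copy α′ ⟩
    detOn Q₁ (map inj₁ shared ++ map inj₂ copy) * detOn D₁ copy ^ α′ ∎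
    where open ≡-Reasoning

  -- Second reduction: β copies of the pair {AB j, B j} of Q₁, sharing U and A.
  data Fixed : Set where
    u a : Fixed

  data Pair : Set where
    ab b : Pair

  ι₂ : Index Fixed Pair β′ → Shared ⊎ Copy
  ι₂ (inj₁ u)        = inj₁ u
  ι₂ (inj₁ a)        = inj₂ a
  ι₂ (inj₂ (j , ab)) = inj₂ (ab j)
  ι₂ (inj₂ (j , b))  = inj₁ (b j)

  fixed : List Fixed
  fixed = u ∷ a ∷ []

  pair : List Pair
  pair = ab ∷ b ∷ []

  A₂ : Fixed → Fixed → ℤ
  A₂ s s′ = Q₁ (ι₂ (inj₁ s)) (ι₂ (inj₁ s′))
  B₂ : Fixed → Pair → ℤ
  B₂ s y = Q₁ (ι₂ (inj₁ s)) (ι₂ (inj₂ (zero , y)))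
  C₂ : Pair → Fixed → ℤ
  C₂ z s = Q₁ (ι₂ (inj₂ (zero , z))) (ι₂ (inj₁ s))
  D₂ : Pair → Pair → ℤ
  D₂ z y = Q₁ (ι₂ (inj₂ (zero , z))) (ι₂ (inj₂ (zero , y)))

  Q₁-copies : ∀ c d → Q₁ (ι₂ c) (ι₂ d) ≡ copiesMatrix A₂ B₂ C₂ D₂ β′ c d
  Q₁-copies (inj₁ _)        (inj₁ _)         = refl
  Q₁-copies (inj₁ u)        (inj₂ (_ , ab))  = refl
  Q₁-copies (inj₁ u)        (inj₂ (_ , b))   = refl
  Q₁-copies (inj₁ a)        (inj₂ (_ , ab))  = refl
  Q₁-copies (inj₁ a)        (inj₂ (_ , b))   = refl
  Q₁-copies (inj₂ (_ , ab)) (inj₁ u)         = refl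
  Q₁-copies (inj₂ (_ , ab)) (inj₁ a)         = refl
  Q₁-copies (inj₂ (_ , b))  (inj₁ u)         = refl
  Q₁-copies (inj₂ (_ , b))  (inj₁ a)         = refl
  Q₁-copies (inj₂ (j , ab)) (inj₂ (j′ , ab)) = scale-diagonal′ x (δ j j′) c₀
  Q₁-copies (inj₂ (j , ab)) (inj₂ (j′ , b))  = scale-off-diagonal x (δ j j′) (Q - + 1)
  Q₁-copies (inj₂ (j , b))  (inj₂ (j′ , ab)) = scale-weighted x (+ α) (δ j j′) ((P - + 1) * (Q - + 1))
  Q₁-copies (inj₂ (j , b))  (inj₂ (j′ , b))  = scale-diagonal x (δ j j′) (Q - + 2)

  Q₁-order : map inj₁ shared ++ map inj₂ copy ↭ map ι₂ (map inj₁ fixed ++ copies pair β′)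
  Q₁-order = begin
    map inj₁ shared ++ map inj₂ copy                                  ≡⟨ cong₂ (λ s c → inj₁ u ∷ s ++ inj₂ a ∷ c)
                                                                             (LP.map-tabulate b inj₁) (LP.map-tabulate ab inj₂) ⟩
    inj₁ u ∷ Bs ++ [ inj₂ a ] ++ ABs                                  ↭⟨ ↭-prep (inj₁ u) (↭.shift (inj₂ a) Bs ABs) ⟩
    inj₁ u ∷ inj₂ a ∷ Bs ++ ABs                                       ↭⟨ ↭-prep (inj₁ u) (↭-prep (inj₂ a) (↭.++-comm Bs ABs)) ⟩
    inj₁ u ∷ inj₂ a ∷ ABs ++ Bs                                       ≡⟨ cong (λ t → inj₁ u ∷ inj₂ a ∷ ABs ++ t)
                                                                             (sym (concat-singletons (λ j → inj₁ (b j)))) ⟩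
    inj₁ u ∷ inj₂ a ∷ ABs ++ concat (tabulate (λ j → [ inj₁ (b j) ])) ↭⟨ ↭-prep (inj₁ u) (↭-prep (inj₂ a)
                                                                             (interleave (λ j → inj₂ (ab j)) (λ j → [ inj₁ (b j) ]))) ⟩
    inj₁ u ∷ inj₂ a ∷ concat (tabulate (λ j → inj₂ (ab j) ∷ [ inj₁ (b j) ]))
                                                                      ≡⟨ sym (map-copies ι₂ fixed pair) ⟩
    map ι₂ (map inj₁ fixed ++ copies pair β′)                         ∎
    where
    open PermutationReasoning
    Bs ABs : List (Shared ⊎ Copy)
    Bs = tabulate (λ j → inj₁ (b j))
    ABs = tabulate (λ j → inj₂ (ab j))

  Q₂ : Fixed ⊎ Pair → Fixed ⊎ Pair → ℤ
  Q₂ = quotientMatrix A₂ B₂ C₂ D₂ (+ β)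

  step₂ : detOn Q₁ (map inj₁ shared ++ map inj₂ copy) ≡ detOn Q₂ (map inj₁ fixed ++ map inj₂ pair) * detOn D₂ pair ^ β′
  step₂ = begin
    detOn Q₁ (map inj₁ shared ++ map inj₂ copy)                       ≡⟨ detOn-↭ Q₁ Q₁-order ⟩
    detOn Q₁ (map ι₂ (map inj₁ fixed ++ copies pair β′))              ≡⟨ detOn-map Q₁ ι₂ (map inj₁ fixed ++ copies pair β′) ⟩
    detOn (λ c d → Q₁ (ι₂ c) (ι₂ d)) (map inj₁ fixed ++ copies pair β′)
                                                                      ≡⟨ detOn-cong (map inj₁ fixed ++ copies pair β′) Q₁-copies ⟩
    detOn (copiesMatrix A₂ B₂ C₂ D₂ β′) (map inj₁ fixed ++ copies pair β′)
                                                                      ≡⟨ det-copies A₂ B₂ C₂ D₂ fixed pair β′ ⟩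
    detOn Q₂ (map inj₁ fixed ++ map inj₂ pair) * detOn D₂ pair ^ β′   ∎
    where open ≡-Reasoning

  -- Third reduction: D₁ consists of β copies of AB j, sharing A.
  ι₃ : Index ⊤ ⊤ β′ → Copy
  ι₃ (inj₁ tt)      = a
  ι₃ (inj₂ (j , _)) = ab j

  A₃ : ⊤ → ⊤ → ℤ
  A₃ _ _ = D₁ a a
  B₃ : ⊤ → ⊤ → ℤ
  B₃ _ _ = D₁ a (ab zero)
  C₃ : ⊤ → ⊤ → ℤ
  C₃ _ _ = D₁ (ab zero) a
  D₃ : ⊤ → ⊤ → ℤ
  D₃ _ _ = D₁ (ab zero) (ab zero)

  D₁-copies : ∀ c d → D₁ (ι₃ c) (ι₃ d) ≡ copiesMatrix A₃ B₃ C₃ D₃ β′ c d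
  D₁-copies (inj₁ _)      (inj₁ _)       = refl
  D₁-copies (inj₁ _)      (inj₂ _)       = refl
  D₁-copies (inj₂ _)      (inj₁ _)       = refl
  D₁-copies (inj₂ (j , _)) (inj₂ (j′ , _)) = scale-diagonal′ x (δ j j′) c₀

  copy-order : map ι₃ (map inj₁ [ tt ] ++ copies [ tt ] β′) ≡ copy
  copy-order = trans (map-copies ι₃ [ tt ] [ tt ]) (cong (a ∷_) (concat-singletons ab))

  Q₃ : ⊤ ⊎ ⊤ → ⊤ ⊎ ⊤ → ℤ
  Q₃ = quotientMatrix A₃ B₃ C₃ D₃ (+ β)

  step₃ : detOn D₁ copy ≡ detOn Q₃ (map inj₁ [ tt ] ++ map inj₂ [ tt ]) * detOn D₃ [ tt ] ^ β′
  step₃ = begin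
    detOn D₁ copy                                                     ≡⟨ cong (detOn D₁) (sym copy-order) ⟩
    detOn D₁ (map ι₃ (map inj₁ [ tt ] ++ copies [ tt ] β′))           ≡⟨ detOn-map D₁ ι₃ (map inj₁ [ tt ] ++ copies [ tt ] β′) ⟩
    detOn (λ c d → D₁ (ι₃ c) (ι₃ d)) (map inj₁ [ tt ] ++ copies [ tt ] β′)
                                                                      ≡⟨ detOn-cong (map inj₁ [ tt ] ++ copies [ tt ] β′) D₁-copies ⟩
    detOn (copiesMatrix A₃ B₃ C₃ D₃ β′) (map inj₁ [ tt ] ++ copies [ tt ] β′)
                                                                      ≡⟨ det-copies A₃ B₃ C₃ D₃ [ tt ] [ tt ] β′ ⟩
    detOn Q₃ (map inj₁ [ tt ] ++ map inj₂ [ tt ]) * detOn D₃ [ tt ] ^ β′ ∎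
    where open ≡-Reasoning

  module Identification (hP : P ^ n - + 1 ≡ + α * (P - + 1)) (hQ : Q ^ m - + 1 ≡ + β * (Q - + 1)) where

    private
      diagonal : ∀ t → x * + 1 - t * + 1 ≡ x * + 1 - t
      diagonal t = cong (_-_ (x * + 1)) (ℤP.*-identityʳ t)
      off-diagonal : ∀ t → x * + 0 - t * + 1 ≡ x * + 0 - t
      off-diagonal t = cong (_-_ (x * + 0)) (ℤP.*-identityʳ t)
      weighted-zero : ∀ w → w * (x * + 0 - + 0) ≡ x * + 0 - + 0
      weighted-zero w = trans (weighted x w (+ 0)) (cong (_-_ (x * + 0)) (ℤP.*-zeroʳ w))

    Q₂-is-xI-T₁ : detOn Q₂ (map inj₁ fixed ++ map inj₂ pair) ≡ φ 4 (T₁ p q n m) x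
    Q₂-is-xI-T₁ = trans (detOn-as-det Q₂ (map inj₁ fixed ++ map inj₂ pair)) (det-cong 4 entry)
      where
      entry : ∀ i j → Q₂ (lookup (map inj₁ fixed ++ map inj₂ pair) i) (lookup (map inj₁ fixed ++ map inj₂ pair) j)
                      ≡ x * I 4 i j - T₁ p q n m i j
      entry 0F 0F = refl
      entry 0F 1F = trans (weighted x (+ α) (P - + 1)) (cong (_-_ (x * + 0)) (sym hP))
      entry 0F 2F = trans (weighted-product x (+ α) (+ β) (P - + 1) (Q - + 1)) (cong₂ (λ s t → x * + 0 - s * t) (sym hP) (sym hQ))
      entry 0F 3F = trans (weighted x (+ β) (Q - + 1)) (cong (_-_ (x * + 0)) (sym hQ))
      entry 1F 0F = refl
      entry 1F 1F = diagonal (P - + 2)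
      entry 1F 2F = trans (weighted-right x (+ β) (P - + 1) (Q - + 1)) (cong (λ t → x * + 0 - (P - + 1) * t) (sym hQ))
      entry 1F 3F = weighted-zero (+ β)
      entry 2F 0F = refl
      entry 2F 1F = off-diagonal (P - + 1)
      entry 2F 2F = diagonal c₀
      entry 2F 3F = off-diagonal (Q - + 1)
      entry 3F 0F = refl
      entry 3F 1F = weighted-zero (+ α)
      entry 3F 2F = trans (weighted-left x (+ α) (P - + 1) (Q - + 1)) (cong (λ s → x * + 0 - s * (Q - + 1)) (sym hP))
      entry 3F 3F = diagonal (Q - + 2)

    D₂-is-g : detOn D₂ pair ≡ g p q n m x
    D₂-is-g = trans (detOn-as-det D₂ pair) (det-cong 2 entry)
      where
      entry : ∀ i j → D₂ (lookup pair i) (lookup pair j) ≡ x * I 2 i j - Gmat p q n m i j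
      entry 0F 0F = diagonal c₀
      entry 0F 1F = off-diagonal (Q - + 1)
      entry 1F 0F = trans (weighted-left x (+ α) (P - + 1) (Q - + 1)) (cong (λ s → x * + 0 - s * (Q - + 1)) (sym hP))
      entry 1F 1F = diagonal (Q - + 2)

    Q₃-is-f : detOn Q₃ (map inj₁ [ tt ] ++ map inj₂ [ tt ]) ≡ f p q n m x
    Q₃-is-f = trans (detOn-as-det Q₃ (map inj₁ [ tt ] ++ map inj₂ [ tt ])) (det-cong 2 entry)
      where
      entry : ∀ i j → Q₃ (lookup (map inj₁ [ tt ] ++ map inj₂ [ tt ]) i) (lookup (map inj₁ [ tt ] ++ map inj₂ [ tt ]) j)
                      ≡ x * I 2 i j - Fmat p q n m i j
      entry 0F 0F = diagonal (P - + 2)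
      entry 0F 1F = trans (weighted-right x (+ β) (P - + 1) (Q - + 1)) (cong (λ t → x * + 0 - (P - + 1) * t) (sym hQ))
      entry 1F 0F = off-diagonal (P - + 1)
      entry 1F 1F = diagonal c₀

    D₃-value : detOn D₃ [ tt ] ≡ x - + (p ℕ.* q) + + p + + q
    D₃-value = begin
      detOn D₃ [ tt ]                  ≡⟨ detOn-as-det D₃ [ tt ] ⟩
      det 1 (λ _ _ → D₃ tt tt)         ≡⟨ det-1 (λ _ _ → D₃ tt tt) ⟩
      x * + 1 - c₀ * + 1               ≡⟨ diagonal c₀ ⟩
      x * + 1 - c₀                     ≡⟨ c₀-as-pq x P Q ⟩
      x - P * Q + P + Q                ≡⟨ cong (λ t → x - t + P + Q) (sym (ℤP.pos-* p q)) ⟩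
      x - + (p ℕ.* q) + P + Q          ∎
      where open ≡-Reasoning

    φ-T₂-factorisation :
      φ (N α β) (T₂ p q n m α β) x
        ≡ (φ 4 (T₁ p q n m) x * g p q n m x ^ β′) * (f p q n m x * (x - + (p ℕ.* q) + + p + + q) ^ β′) ^ α′
    φ-T₂-factorisation = begin
      φ (N α β) (T₂ p q n m α β) x
        ≡⟨ step₁ ⟩
      detOn Q₁ (map inj₁ shared ++ map inj₂ copy) * detOn D₁ copy ^ α′
        ≡⟨ cong₂ (λ s t → s * t ^ α′) step₂ step₃ ⟩
      (detOn Q₂ (map inj₁ fixed ++ map inj₂ pair) * detOn D₂ pair ^ β′)
        * (detOn Q₃ (map inj₁ [ tt ] ++ map inj₂ [ tt ]) * detOn D₃ [ tt ] ^ β′) ^ α′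
        ≡⟨ cong₂ (λ s t → s * t ^ α′) (cong₂ (λ s t → s * t ^ β′) Q₂-is-xI-T₁ D₂-is-g)
                                       (cong₂ (λ s t → s * t ^ β′) Q₃-is-f D₃-value) ⟩
      (φ 4 (T₁ p q n m) x * g p q n m x ^ β′) * (f p q n m x * (x - + (p ℕ.* q) + + p + + q) ^ β′) ^ α′ ∎
      where open ≡-Reasoning

pos-^ : ∀ a k → (+ a) ^ k ≡ + (a ℕ.^ k)
pos-^ a zero    = refl
pos-^ a (suc k) = trans (cong (+ a *_) (pos-^ a k)) (sym (ℤP.pos-* a (a ℕ.^ k)))

pos-∸ : ∀ {a b} → b ℕ.≤ a → + a - + b ≡ + (a ∸ b)
pos-∸ {a} {b} b≤a = trans (ℤP.m-n≡m⊖n a b) (ℤP.⊖-≥ b≤a)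

^-distribʳ-* : ∀ a b k → (a * b) ^ k ≡ a ^ k * b ^ k
^-distribʳ-* a b zero    = refl
^-distribʳ-* a b (suc k) = trans (cong ((a * b) *_) (^-distribʳ-* a b k)) (*-interchange a b (a ^ k) (b ^ k))

geometric-sum : ∀ p k c → 1 ℕ.≤ p → c ℕ.* (p ∸ 1) ≡ p ℕ.^ k ∸ 1 → (+ p) ^ k - + 1 ≡ + c * (+ p - + 1)
geometric-sum p k c 1≤p sum = begin
  (+ p) ^ k - + 1          ≡⟨ cong (_- + 1) (pos-^ p k) ⟩
  + (p ℕ.^ k) - + 1        ≡⟨ pos-∸ (subst (ℕ._≤ p ℕ.^ k) (ℕP.^-zeroˡ k) (ℕP.^-monoˡ-≤ k 1≤p)) ⟩
  + (p ℕ.^ k ∸ 1)          ≡⟨ cong +_ (sym sum) ⟩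
  + (c ℕ.* (p ∸ 1))        ≡⟨ ℤP.pos-* c (p ∸ 1) ⟩
  + c * + (p ∸ 1)          ≡⟨ cong (+ c *_) (sym (pos-∸ 1≤p)) ⟩
  + c * (+ p - + 1)        ∎
  where open ≡-Reasoning

1≤prime : ∀ {p} → Prime p → 1 ℕ.≤ p
1≤prime {p} p-prime = ℕP.<⇒≤ (ℕ.nonTrivial⇒n>1 p {{prime⇒nonTrivial p-prime}})

prime^k∸1≢0 : ∀ {p} k → Prime p → NonZero k → 0 ≢ p ℕ.^ k ∸ 1
prime^k∸1≢0 {p} (suc k) p-prime _ = ℕP.<⇒≢ (ℕP.m<n⇒0<n∸m 1<p^1+k)
  where
  2≤p = ℕ.nonTrivial⇒n>1 p {{prime⇒nonTrivial p-prime}}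
  1<p^1+k : 1 ℕ.< p ℕ.^ suc k
  1<p^1+k = ℕP.*-mono-≤ 2≤p (subst (ℕ._≤ p ℕ.^ k) (ℕP.^-zeroˡ k) (ℕP.^-monoˡ-≤ k (1≤prime p-prime)))

collect-powers : ∀ a b c d k l → (a * b ^ l) * (c * d ^ l) ^ k ≡ a * d ^ (k ℕ.* l) * c ^ k * b ^ l
collect-powers a b c d k l = begin
  (a * b ^ l) * (c * d ^ l) ^ k           ≡⟨ cong ((a * b ^ l) *_) (^-distribʳ-* c (d ^ l) k) ⟩
  (a * b ^ l) * (c ^ k * (d ^ l) ^ k)     ≡⟨ cong (λ e → (a * b ^ l) * (c ^ k * e)) (ℤP.^-*-assoc d l k) ⟩
  (a * b ^ l) * (c ^ k * d ^ (l ℕ.* k))   ≡⟨ cong (λ e → (a * b ^ l) * (c ^ k * d ^ e)) (ℕP.*-comm l k) ⟩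
  (a * b ^ l) * (c ^ k * d ^ (k ℕ.* l))   ≡⟨ regroup a (b ^ l) (c ^ k) (d ^ (k ℕ.* l)) ⟩
  a * d ^ (k ℕ.* l) * c ^ k * b ^ l       ∎
  where
  open ≡-Reasoning
  regroup : ∀ a b c e → (a * b) * (c * e) ≡ a * e * c * b
  regroup = solve-∀

lemma4p6 : (p q n m : ℕ) → Prime p → Prime q → p ≢ q → NonZero n → NonZero m →
           (α β : ℕ) → α ℕ.* (p ∸ 1) ≡ p ℕ.^ n ∸ 1 → β ℕ.* (q ∸ 1) ≡ q ℕ.^ m ∸ 1 →
           (x : ℤ) →
           φ (N α β) (T₂ p q n m α β) x
             ≡ φ 4 (T₁ p q n m) x
               * (x - + (p ℕ.* q) + + p + + q) ^ ((α ∸ 1) ℕ.* (β ∸ 1))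
               * f p q n m x ^ (α ∸ 1)
               * g p q n m x ^ (β ∸ 1)
lemma4p6 p q n m p-prime q-prime _ n≢0 m≢0 zero β αsum βsum x = ⊥-elim (prime^k∸1≢0 n p-prime n≢0 αsum)
lemma4p6 p q n m p-prime q-prime _ n≢0 m≢0 (suc α′) zero αsum βsum x = ⊥-elim (prime^k∸1≢0 m q-prime m≢0 βsum)
lemma4p6 p q n m p-prime q-prime _ n≢0 m≢0 (suc α′) (suc β′) αsum βsum x =
  trans φ-T₂-factorisation (collect-powers (φ 4 (T₁ p q n m) x) (g p q n m x) (f p q n m x) (x - + (p ℕ.* q) + + p + + q) α′ β′)
  where
  open Reduction p q n m α′ β′ x
  open Identification (geometric-sum p n α (1≤prime p-prime) αsum) (geometric-sum q m β (1≤prime q-prime) βsum)
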